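{- Let $g\ge 3$ and $2\le k<g$ be integers such that $k+1$ divides $g$, and suppose that the $(g,k)$ Young graph exists and is the 1089 graph. Let $b=g/(k+1)$. Then: (i) The $(g,k)$ Young graph has the starting node $[[0,0]]$ and the four non-starting nodes $[0,0]$, $[0,k-1]$, $[k-1,k-1]$, $[k-1,0]$, and exactly the following labelled edges: $[[0,0]]\xrightarrow{(b,\,kb)}[0,k-1]$, $[0,0]\xrightarrow{(0,\,0)}[0,0]$, $[0,0]\xrightarrow{(b,\,kb)}[0,k-1]$, $[0,k-1]\xrightarrow{(b-1,\,kb-1)}[k-1,k-1]$, $[k-1,k-1]\xrightarrow{(g-1,\,g-1)}[k-1,k-1]$, $[k-1,k-1]\xrightarrow{(kb-1,\,b-1)}[k-1,0]$, $[k-1,0]\xrightarrow{(kb,\,b)}[0,0]$. The two pivot nodes are $[0,0]$ and $[k-1,k-1]$. (ii) The generating function of the $(g,k)$-reverse multiples is $$\mathcal C(x)=\frac{x^4(1+x)}{1-x^2-x^4}.$$ (iii) The $(g,k)$-reverse multiples are exactly the numbers $\gamma\beta$, where $\gamma=b(g^2-1)=(b-1,\,g-1,\,kb)_g$ and $\beta$ ranges over all positive integers whose base-$g$ expansion is palindromic, uses only the digits $0$ and $1$, and contains no single $0$'s or $1$'s (i.e. every maximal run of consecutive equal digits has length at least $2$). (iv) The shortest $(g,k)$-reverse multiple has length $4$, and for every $t\ge 4$ the number of $(g,k)$-reverse multiples of length $t$ is $F_{\lfloor t/2\rfloor-1}$.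
   Context: Notation: $(a_{n-1},\dots,a_1,a_0)_g$ denotes $\sum_{i=0}^{n-1}a_ig^i$ with digits $0\le a_i<g$; if $a_{n-1}\ne0$ the number has length $n$. For integers $g\ge3$, $2\le k<g$, a positive integer $N=(a_{n-1},\dots,a_0)_g$ with $a_{n-1}\neq 0$ is a $(g,k)$-reverse multiple if $kN=(a_0,a_1,\dots,a_{n-1})_g$ (the base-$g$ reversal of $N$, in particular $a_0\ne0$). Let $c_t$ be the number of $(g,k)$-reverse multiples of length $t$ and $\mathcal C(x)=\sum_{t\ge0}c_tx^t$. $F_n$ denotes the Fibonacci numbers with $F_1=F_2=1$, $F_{n}=F_{n-1}+F_{n-2}$. Young graph. The directed edge-labelled graph $H(g,k)$ is defined as follows. Its possible nodes are a distinguished starting node, written $[[0,0]]$, and ordered pairs $[s,r]$ of integers with $0\le s,r\le k-1$ (the pair $[0,0]$ is a node distinct from the starting node). For a node $[s,r]$ (the starting node being treated as $s=r=0$) and each pair of digits $(c,a)$, $0\le a,c\le g-1$, with $ka+r\equiv c \pmod g$ and $0\le a+sg-kc\le k-1$, there is a directed edge labelled $(c,a)$ from $[s,r]$ to the node $[\,a+sg-kc,\ (ka+r-c)/g\,]$; for edges leaving the starting node one additionally requires $a\ne0$ and $c\ne0$. $H(g,k)$ consists of the starting node, the nodes reachable from it by directed paths, and all edges leaving these nodes. A non-starting node of the form $[r,r]$ ($r\ge0$, including $[0,0]$) is an even pivot node; a non-starting node is an odd pivot node if it is of the form $[r,r]$ and carries a loop, or is of the form $[r',r]$ with $r'\ne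 r$ and has an edge to $[r,r']$. The $(g,k)$ Young graph exists if $H(g,k)$ contains a node $[r,r]$ with $r\ne0$ or an edge $[r',r]\to[r,r']$ with $r'\ne r$; it is then obtained from $H(g,k)$ by deleting every node from which no pivot node can be reached by a directed path, together with all edges incident to such nodes. Two Young graphs are isomorphic if there is an isomorphism of the underlying (unlabelled) directed graphs sending starting node to starting node, even pivot nodes onto even pivot nodes and odd pivot nodes onto odd pivot nodes. The 1089 graph: a Young graph is "the 1089 graph" if it is isomorphic to the graph with starting node $S$ and non-starting nodes $U,V,W,X$, with edges $S\to V$, $U\to U$, $U\to V$, $V\to W$, $W\to W$, $W\to X$, $X\to U$, in which $U$ and $W$ are both even and odd pivot nodes and $V,X$ are not pivot nodes. -}

module Defs where

open import Data.Nat using (ℕ; zero; suc; _+_; _*_; _∸_; _<_; _≤_; _<?_)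
open import Data.Nat.Properties using (_≟_)
open import Data.Integer as ℤ using (ℤ; +_; -[1+_])
open import Data.List using (List; []; _∷_; reverse; length; map; concatMap; upTo; filter; lookup; foldr)
open import Data.List.Relation.Unary.All as All using (All)
open import Data.List.Membership.Propositional using (_∈_)
open import Data.Fin using (Fin; toℕ)
open import Data.Product using (Σ; ∃; ∃₂; _×_; _,_)
open import Data.Product.Properties using ()
open import Data.Sum using (_⊎_)
open import Data.Empty using (⊥)
open import Relation.Nullary using (¬_; Dec; yes; no)
open import Relation.Nullary.Decidable using (_×-dec_; ¬?)
open import Relation.Unary using (Decidable)
open import Relation.Binary.PropositionalEquality using (_≡_; _≢_)
open import Function.Bundles using (_⇔_)

-- Base-g digit lists.  A digit list is little-endian:
-- (a₀ ∷ a₁ ∷ … ∷ a_{n-1} ∷ [])  represents  (a_{n-1},…,a₁,a₀)_g.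

val : ℕ → List ℕ → ℕ
val g []       = 0
val g (d ∷ ds) = d + g * val g ds

HeadNZ : List ℕ → Set
HeadNZ []      = ⊥
HeadNZ (x ∷ _) = x ≢ 0

headNZ? : Decidable HeadNZ
headNZ? []      = no (λ ())
headNZ? (x ∷ _) = ¬? (x ≟ 0)

-- ds is the base-g expansion (a₀,…,a_{n-1}) of a (g,k)-reverse multiple:
-- digits < g, a_{n-1} ≠ 0 (leading digit), a₀ ≠ 0, and k·N equals the reversal.
IsRMDigits : ℕ → ℕ → List ℕ → Set
IsRMDigits g k ds =
  All (_< g) ds × HeadNZ (reverse ds) × HeadNZ ds × k * val g ds ≡ val g (reverse ds)

isRMDigits? : ∀ g k → Decidable (IsRMDigits g k)
isRMDigits? g k ds =
  All.all? (_<? g) ds ×-dec headNZ? (reverse ds) ×-dec headNZ? ds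
    ×-dec (k * val g ds ≟ val g (reverse ds))

IsReverseMultiple : ℕ → ℕ → ℕ → Set
IsReverseMultiple g k N = ∃ λ ds → IsRMDigits g k ds × val g ds ≡ N

lists : ℕ → ℕ → List (List ℕ)
lists g zero    = [] ∷ []
lists g (suc t) = concatMap (λ d → map (d ∷_) (lists g t)) (upTo g)

-- c_t : number of (g,k)-reverse multiples of length t
-- (a number of length t corresponds to exactly one digit list of length t
--  with nonzero leading digit)
count : ℕ → ℕ → ℕ → ℕ
count g k t = length (filter (isRMDigits? g k) (lists g t))

Series : Set
Series = ℕ → ℤ

sumℤ : List ℤ → ℤ
sumℤ = foldr ℤ._+_ (+ 0)

_⊛_ : Series → Series → Series
(f ⊛ h) n = sumℤ (map (λ i → f i ℤ.* h (n ∸ i)) (upTo (suc n)))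

poly : List ℤ → Series
poly []       n       = + 0
poly (c ∷ cs) zero    = c
poly (c ∷ cs) (suc n) = poly cs n

genFun : ℕ → ℕ → Series
genFun g k t = + count g k t

fib : ℕ → ℕ
fib zero          = 0
fib (suc zero)    = 1
fib (suc (suc n)) = fib (suc n) + fib n

data Node : Set where
  start : Node              -- the starting node [[0,0]]
  node  : ℕ → ℕ → Node

-- edge labelled (c,a) from [s,r] to [s',r']:
--   c,a < g,  0 ≤ a + s g − k c = s' ≤ k−1,  k a + r = c + g r'
-- (the last equation is equivalent to  k a + r ≡ c (mod g)  and
--  r' = (k a + r − c)/g, since c < g).
Step : ℕ → ℕ → ℕ → ℕ → ℕ → ℕ → ℕ → ℕ → Set
Step g k s r c a s' r' =
  c < g × a < g × s' < k × k * c + s' ≡ a + s * g × k * a + r ≡ c + g * r'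

Edge : ℕ → ℕ → Node → ℕ → ℕ → Node → Set
Edge g k u          c a start        = ⊥
Edge g k start      c a (node s' r') = Step g k 0 0 c a s' r' × a ≢ 0 × c ≢ 0
Edge g k (node s r) c a (node s' r') = Step g k s r c a s' r'

data Path (g k : ℕ) : Node → Node → Set where
  []  : ∀ {u} → Path g k u u
  _∷_ : ∀ {u v w c a} → Edge g k u c a v → Path g k v w → Path g k u w

InH : ℕ → ℕ → Node → Set
InH g k v = Path g k start v

EvenPivot : ℕ → ℕ → Node → Set
EvenPivot g k start      = ⊥
EvenPivot g k (node s r) = InH g k (node s r) × s ≡ r

OddPivot : ℕ → ℕ → Node → Set
OddPivot g k start      = ⊥
OddPivot g k (node s r) = InH g k (node s r) ×
  ((s ≡ r × ∃₂ λ c a → Edge g k (node s r) c a (node s r)) ⊎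
   (s ≢ r × ∃₂ λ c a → Edge g k (node s r) c a (node r s)))

Pivot : ℕ → ℕ → Node → Set
Pivot g k v = EvenPivot g k v ⊎ OddPivot g k v

YoungExists : ℕ → ℕ → Set
YoungExists g k =
  (∃ λ r → r ≢ 0 × InH g k (node r r)) ⊎
  (∃₂ λ r' r → r' ≢ r × InH g k (node r' r) ×
     ∃₂ λ c a → Edge g k (node r' r) c a (node r r'))

InY : ℕ → ℕ → Node → Set
InY g k v = InH g k v × ∃ λ w → Pivot g k w × Path g k v w

EdgeY : ℕ → ℕ → Node → ℕ → ℕ → Node → Set
EdgeY g k u c a v = InY g k u × InY g k v × Edge g k u c a v

AdjY : ℕ → ℕ → Node → Node → Set
AdjY g k u v = ∃₂ λ c a → EdgeY g k u c a v

data V1089 : Set where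
  S U V W X : V1089

data E1089 : V1089 → V1089 → Set where
  SV : E1089 S V
  UU : E1089 U U
  UV : E1089 U V
  VW : E1089 V W
  WW : E1089 W W
  WX : E1089 W X
  XU : E1089 X U

Even1089 : V1089 → Set
Even1089 x = x ≡ U ⊎ x ≡ W

Odd1089 : V1089 → Set
Odd1089 x = x ≡ U ⊎ x ≡ W

IsIso1089 : ℕ → ℕ → (V1089 → Node) → Set
IsIso1089 g k f =
  f S ≡ start ×
  (∀ x y → f x ≡ f y → x ≡ y) ×
  (∀ x → InY g k (f x)) ×
  (∀ v → InY g k v → ∃ λ x → f x ≡ v) ×
  (∀ x y → E1089 x y ⇔ AdjY g k (f x) (f y)) ×
  (∀ x → Even1089 x ⇔ EvenPivot g k (f x)) ×
  (∀ x → Odd1089 x ⇔ OddPivot g k (f x))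

Is1089 : ℕ → ℕ → Set
Is1089 g k = YoungExists g k × ∃ (IsIso1089 g k)

nodes1089 : ℕ → List Node
nodes1089 k = start ∷ node 0 0 ∷ node 0 (k ∸ 1) ∷ node (k ∸ 1) (k ∸ 1) ∷ node (k ∸ 1) 0 ∷ []

edges1089 : ℕ → ℕ → ℕ → List (Node × ℕ × ℕ × Node)
edges1089 g k b =
  (start              , b         , k * b     , node 0 (k ∸ 1)) ∷
  (node 0 0           , 0         , 0         , node 0 0) ∷
  (node 0 0           , b         , k * b     , node 0 (k ∸ 1)) ∷
  (node 0 (k ∸ 1)     , b ∸ 1     , k * b ∸ 1 , node (k ∸ 1) (k ∸ 1)) ∷
  (node (k ∸ 1) (k ∸ 1) , g ∸ 1   , g ∸ 1     , node (k ∸ 1) (k ∸ 1)) ∷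
  (node (k ∸ 1) (k ∸ 1) , k * b ∸ 1 , b ∸ 1   , node (k ∸ 1) 0) ∷
  (node (k ∸ 1) 0     , k * b     , b         , node 0 0) ∷ []

-- every entry equals one of its neighbours (no maximal run of length 1)
NoSingles : List ℕ → Set
NoSingles ds = ∀ (i : Fin (length ds)) → ∃ λ (j : Fin (length ds)) →
  (toℕ j ≡ suc (toℕ i) ⊎ toℕ i ≡ suc (toℕ j)) × lookup ds j ≡ lookup ds i

IsBeta : ℕ → ℕ → Set
IsBeta g β = 0 < β × ∃ λ ds →
  All (_< g) ds × HeadNZ (reverse ds) × val g ds ≡ β ×
  ds ≡ reverse ds × All (λ d → d ≡ 0 ⊎ d ≡ 1) ds × NoSingles ds

module Submission where

-- A reverse multiple N, with k N = rev N, is read from both ends at once.  Matching the outer digit pair (c, a)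
-- of N with the outer pair of k N leaves inner digits M with k M + r = rev M + s g^|M| for carries [s, r], and
-- the passage [s, r] → [s', r'] labelled (c, a) is exactly an edge of H(g,k).  Peeling stops at an empty or a
-- one-digit core, that is at an even or an odd pivot, so the reverse multiples are the labels of the walks
-- from the starting node to a pivot, all of which lie in the Young graph.  For the 1089 graph the isomorphism
-- must send S, U, V, W, X to [[0,0]], [0,0], [0,k-1], [k-1,k-1], [k-1,0], and as two labels of one edge would
-- differ by some d with k² d = d, every label is forced.  Counting walks gives a Fibonacci recursion, whence
-- (ii) and (iv).  Reading U, V, W, X as the bit pairs 00, 01, 11, 10 turns a walk into a palindromic bit
-- string β without single bits, and the labels along it are the digits of b (g² - 1) β, whence (iii).

open import Defs
open import Data.Nat
open import Data.Nat.Properties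
open import Data.Nat.DivMod
  using (_/_; _%_; m≡m%n+[m/n]*n; m%n<n; [m+kn]%n≡m%n; m<n⇒m%n≡m; m*n/n≡m; m/n≡1+[m∸n]/n)
open import Data.Nat.Divisibility using (_∣_; divides)
open import Data.Nat.Tactic.RingSolver using (solve-∀)
open import Data.Integer as ℤ using (ℤ; +_; -[1+_])
import Data.Integer.Properties as ℤₚ
import Data.Integer.Tactic.RingSolver as ℤ-Solver
open import Data.Fin using (Fin; toℕ; fromℕ<) renaming (zero to fzero; suc to fsuc)
open import Data.Fin.Properties using (toℕ<n; toℕ-fromℕ<)
open import Data.List
  using (List; []; _∷_; _++_; _∷ʳ_; [_]; reverse; length; lookup; map; filter; drop; upTo; initLast; _∷ʳ′_)
open import Data.List.Properties
  using (length-++; length-map; reverse-++; unfold-reverse; length-reverse; ++-assoc; map-++; map-cong; upTo-∷ʳ;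
         ∷-injectiveˡ; ∷-injectiveʳ; ∷ʳ-injective)
open import Data.List.Relation.Unary.Any using (here; there)
open import Data.List.Relation.Unary.All as All using (All; []; _∷_)
import Data.List.Relation.Unary.All.Properties as Allₚ
import Data.List.Relation.Unary.AllPairs as AllPairs
import Data.List.Relation.Unary.AllPairs.Properties as AllPairsₚ
open import Data.List.Relation.Unary.Unique.Propositional using (Unique; []; _∷_)
import Data.List.Relation.Unary.Unique.Propositional.Properties as Uniqueₚ
open import Data.List.Relation.Binary.Disjoint.Propositional using (Disjoint)
open import Data.List.Membership.Propositional using (_∈_; find; lose)
open import Data.List.Membership.Propositional.Properties
  using (∈-map⁺; ∈-map⁻; ∈-++⁺ˡ; ∈-++⁺ʳ; ∈-++⁻; ∈-filter⁺; ∈-filter⁻; ∈-concatMap⁺; ∈-concatMap⁻;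
         ∈-upTo⁺; ∈-upTo⁻)
open import Data.List.Membership.Propositional.Properties.WithK using (unique∧set⇒bag)
open import Data.List.Relation.Binary.BagAndSetEquality using (∼bag⇒↭)
open import Data.List.Relation.Binary.Permutation.Propositional.Properties using (↭-length)
open import Data.Product using (Σ; ∃; ∃₂; _×_; _,_; proj₁; proj₂)
open import Data.Sum using (_⊎_; inj₁; inj₂)
open import Data.Unit using (⊤; tt)
open import Data.Empty using (⊥-elim)
open import Relation.Binary.PropositionalEquality hiding ([_])
open import Relation.Nullary using (¬_; yes; no)
open import Function.Base using (id)
open import Function.Bundles using (_⇔_; mk⇔; Equivalence)

-- Digit lists

wrap : ℕ → List ℕ → ℕ → List ℕ
wrap a M c = a ∷ M ++ [ c ]

length-∷ʳ : ∀ (M : List ℕ) c → length (M ∷ʳ c) ≡ suc (length M)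
length-∷ʳ M c = trans (length-++ M) (+-comm (length M) 1)

length-wrap : ∀ a M c → length (wrap a M c) ≡ 2 + length M
length-wrap a M c = cong suc (length-∷ʳ M c)

reverse-wrap : ∀ a M c → reverse (wrap a M c) ≡ wrap c (reverse M) a
reverse-wrap a M c rewrite unfold-reverse a (M ∷ʳ c) | reverse-++ M [ c ] = refl

wrap-injective : ∀ {a c M M′} → wrap a M c ≡ wrap a M′ c → M ≡ M′
wrap-injective {M = M} {M′} eq = proj₁ (∷ʳ-injective M M′ (∷-injectiveʳ eq))

All-wrap⁻ : ∀ {P : ℕ → Set} {a M c} → All P (wrap a M c) → P a × All P M × P c
All-wrap⁻ (pa ∷ pMc) with Allₚ.∷ʳ⁻ pMc
... | pM , pc = pa , pM , pc

All-wrap⁺ : ∀ {P : ℕ → Set} {a M c} → P a → All P M → P c → All P (wrap a M c)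
All-wrap⁺ pa pM pc = pa ∷ Allₚ.∷ʳ⁺ pM pc

All-reverse : ∀ {P : ℕ → Set} {xs} → All P xs → All P (reverse xs)
All-reverse [] = []
All-reverse {xs = x ∷ xs} (px ∷ pxs) rewrite unfold-reverse x xs = Allₚ.∷ʳ⁺ (All-reverse pxs) px

data Shells : List ℕ → Set where
  empty  : Shells []
  single : ∀ a → Shells [ a ]
  layer  : ∀ a {M} c → Shells M → Shells (wrap a M c)

shells : ∀ ds → Shells ds
shells ds = peel (length ds) ds ≤-refl
  where
  peel : ∀ n ds → length ds ≤ n → Shells ds
  peel _ [] _ = empty
  peel (suc n) (a ∷ t) (s≤s ≤n) with initLast t
  ... | [] = single a
  ... | M ∷ʳ′ c = layer a c (peel n M (<⇒≤ (subst (_≤ n) (length-∷ʳ M c) ≤n)))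

val-++ : ∀ g xs ys → val g (xs ++ ys) ≡ val g xs + g ^ length xs * val g ys
val-++ g [] ys = sym (+-identityʳ (val g ys))
val-++ g (x ∷ xs) ys rewrite val-++ g xs ys = distrib g x (val g xs) (g ^ length xs) (val g ys)
  where
  distrib : ∀ g x A P Y → x + g * (A + P * Y) ≡ x + g * A + g * P * Y
  distrib = solve-∀

val-∷ʳ : ∀ g M c → val g (M ∷ʳ c) ≡ val g M + g ^ length M * c
val-∷ʳ g M c rewrite val-++ g M [ c ] | *-zeroʳ g | +-identityʳ c = refl

val<g^length : ∀ {g ds} → All (_< g) ds → val g ds < g ^ length ds
val<g^length [] = s≤s z≤n
val<g^length {g} {x ∷ xs} (x<g ∷ xs<g) = begin-strict
  x + g * val g xs    <⟨ +-monoˡ-< (g * val g xs) x<g ⟩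
  g + g * val g xs    ≡⟨ sym (*-suc g (val g xs)) ⟩
  g * suc (val g xs)  ≤⟨ *-monoʳ-≤ g (val<g^length xs<g) ⟩
  g * g ^ length xs   ∎
  where open ≤-Reasoning

digit-unique : ∀ g .{{_ : NonZero g}} {x x' y y'} → x < g → x' < g → x + y * g ≡ x' + y' * g → x ≡ x' × y ≡ y'
digit-unique g {x} {x'} {y} {y'} x<g x'<g e =
  x≡x' , *-cancelʳ-≡ y y' g (+-cancelˡ-≡ x _ _ (trans e (cong (_+ y' * g) (sym x≡x'))))
  where
  x≡x' : x ≡ x'
  x≡x' = begin
    x                ≡⟨ sym (m<n⇒m%n≡m x<g) ⟩
    x % g            ≡⟨ sym ([m+kn]%n≡m%n x y g) ⟩
    (x + y * g) % g  ≡⟨ cong (_% g) e ⟩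
    (x' + y' * g) % g ≡⟨ [m+kn]%n≡m%n x' y' g ⟩
    x' % g           ≡⟨ m<n⇒m%n≡m x'<g ⟩
    x'               ∎
    where open ≡-Reasoning

-- The carry equation and the graph H(g,k)

-- r is the carry into the low end of ds and s the excess at its high end, left over from the outer digit
-- pairs of a reverse multiple that have already been matched.
CarryEq : ℕ → ℕ → ℕ → ℕ → List ℕ → Set
CarryEq g k s r ds = k * val g ds + r ≡ val g (reverse ds) + s * g ^ length ds

CarryEq-wrap : ∀ g k s r a M c →
  let A = val g M; R = val g (reverse M); P = g ^ length M in
  CarryEq g k s r (wrap a M c) ≡
  ((k * a + r) + (k * A + P * (k * c)) * g ≡ c + (R + P * (a + s * g)) * g)
CarryEq-wrap g k s r a M c
  rewrite reverse-wrap a M c | length-∷ʳ M c | val-∷ʳ g M c | val-∷ʳ g (reverse M) a | length-reverse M =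
  cong₂ _≡_ (lhs g k r a (val g M) (g ^ length M) c) (rhs g s a (val g (reverse M)) (g ^ length M) c)
  where
  lhs : ∀ g k r a A P c → k * (a + g * (A + P * c)) + r ≡ (k * a + r) + (k * A + P * (k * c)) * g
  lhs = solve-∀
  rhs : ∀ g s a R P c → c + g * (R + P * a) + s * (g * (g * P)) ≡ c + (R + P * (a + s * g)) * g
  rhs = solve-∀

split-low-digit : ∀ g .{{_ : NonZero g}} {x y c z} → c < g → x + y * g ≡ c + z * g →
  ∃ λ q → x ≡ c + g * q × q + y ≡ z
split-low-digit g {x} {y} {c} {z} c<g e =
  x / g , trans (m≡m%n+[m/n]*n x g) (cong₂ _+_ x%g≡c (*-comm (x / g) g)) , q+y≡z
  where
  open ≡-Reasoning
  split : x % g + (x / g + y) * g ≡ c + z * g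
  split = begin
    x % g + (x / g + y) * g        ≡⟨ cong (λ z → x % g + z) (*-distribʳ-+ g (x / g) y) ⟩
    x % g + (x / g * g + y * g)    ≡⟨ sym (+-assoc (x % g) _ _) ⟩
    x % g + x / g * g + y * g      ≡⟨ cong (_+ y * g) (sym (m≡m%n+[m/n]*n x g)) ⟩
    x + y * g                      ≡⟨ e ⟩
    c + z * g                      ∎
  x%g≡c = proj₁ (digit-unique g {y = x / g + y} {z} (m%n<n x g) c<g split)
  q+y≡z = proj₂ (digit-unique g {y = x / g + y} {z} (m%n<n x g) c<g split)

high-part-≤ : ∀ P {L y R z} → R < P → L + P * y ≡ R + P * z → y ≤ z
high-part-≤ P {L} {y} {R} {z} R<P e with y ≤? z
... | yes y≤z = y≤z
... | no y≰z = ⊥-elim (<⇒≢ (begin-strict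
  R + P * z      <⟨ +-monoˡ-< (P * z) R<P ⟩
  P + P * z      ≡⟨ sym (*-suc P z) ⟩
  P * suc z      ≤⟨ *-monoʳ-≤ P (≰⇒> y≰z) ⟩
  P * y          ≤⟨ m≤n+m (P * y) L ⟩
  L + P * y      ∎) (sym e))
  where open ≤-Reasoning

carry<k : ∀ {g k a r c r'} → a < g → r < k → k * a + r ≡ c + g * r' → r' < k
carry<k {g} {k} {a} {r} {c} {r'} a<g r<k e = *-cancelˡ-< g r' k (begin-strict
  g * r'      ≤⟨ m≤n+m (g * r') c ⟩
  c + g * r'  ≡⟨ sym e ⟩
  k * a + r   <⟨ +-monoʳ-< (k * a) r<k ⟩
  k * a + k   ≡⟨ +-comm (k * a) k ⟩
  k + k * a   ≡⟨ sym (*-suc k a) ⟩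
  k * suc a   ≤⟨ *-monoʳ-≤ k a<g ⟩
  k * g       ≡⟨ *-comm k g ⟩
  g * k       ∎)
  where open ≤-Reasoning

-- The equation read modulo g gives the low digit and the carry r'; comparing the rest with
-- rev M < g^|M| gives the new excess s'.
carryEq-wrap⁻ : ∀ {g k s r a c M} → r < k → a < g → c < g → All (_< g) M →
  CarryEq g k s r (wrap a M c) → ∃₂ λ s' r' → Step g k s r c a s' r' × CarryEq g k s' r' M
carryEq-wrap⁻ {g@(suc _)} {k} {s} {r} {a} {c} {M} r<k a<g c<g M<g eq =
  s' , r' , (c<g , a<g , s'<k , kc+s'≡ , low) ,
  trans (+-comm (k * A) r') (trans middle (cong (λ z → R + z) (*-comm P s')))
  where
  A = val g M
  R = val g (reverse M)
  P = g ^ length M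
  digit = split-low-digit g c<g (subst id (CarryEq-wrap g k s r a M c) eq)
  r' = proj₁ digit
  low : k * a + r ≡ c + g * r'
  low = proj₁ (proj₂ digit)
  high : (r' + k * A) + P * (k * c) ≡ R + P * (a + s * g)
  high = trans (+-assoc r' (k * A) _) (proj₂ (proj₂ digit))
  R<P : R < P
  R<P = subst (R <_) (cong (g ^_) (length-reverse M)) (val<g^length (All-reverse M<g))
  s' = a + s * g ∸ k * c
  kc+s'≡ : k * c + s' ≡ a + s * g
  kc+s'≡ = m+[n∸m]≡n (high-part-≤ P R<P high)
  middle : r' + k * A ≡ R + P * s'
  middle = +-cancelʳ-≡ (P * (k * c)) _ _ (begin
    r' + k * A + P * (k * c)  ≡⟨ high ⟩
    R + P * (a + s * g)       ≡⟨ cong (λ z → R + P * z) (sym kc+s'≡) ⟩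
    R + P * (k * c + s')      ≡⟨ shuffle R P (k * c) s' ⟩
    R + P * s' + P * (k * c)  ∎)
    where
    open ≡-Reasoning
    shuffle : ∀ R P x y → R + P * (x + y) ≡ R + P * y + P * x
    shuffle = solve-∀
  s'<k : s' < k
  s'<k = *-cancelˡ-< P s' k (begin-strict
    P * s'      ≤⟨ m≤n+m (P * s') R ⟩
    R + P * s'  ≡⟨ sym middle ⟩
    r' + k * A  <⟨ +-monoˡ-< (k * A) (carry<k {c = c} a<g r<k low) ⟩
    k + k * A   ≡⟨ sym (*-suc k A) ⟩
    k * suc A   ≤⟨ *-monoʳ-≤ k (val<g^length M<g) ⟩
    k * P       ≡⟨ *-comm k P ⟩
    P * k       ∎)
    where open ≤-Reasoning

carryEq-wrap⁺ : ∀ {g k s r a c M s' r'} → Step g k s r c a s' r' → CarryEq g k s' r' M →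
  CarryEq g k s r (wrap a M c)
carryEq-wrap⁺ {g} {k} {s} {r} {a} {c} {M} {s'} {r'} (_ , _ , _ , kc+s'≡ , low) eq =
  subst id (sym (CarryEq-wrap g k s r a M c)) (begin
    (k * a + r) + (k * A + P * (k * c)) * g   ≡⟨ cong (_+ (k * A + P * (k * c)) * g) low ⟩
    (c + g * r') + (k * A + P * (k * c)) * g  ≡⟨ regroup c g r' (k * A) (P * (k * c)) ⟩
    c + ((k * A + r') + P * (k * c)) * g      ≡⟨ cong (λ z → c + (z + P * (k * c)) * g) eq ⟩
    c + ((R + s' * P) + P * (k * c)) * g      ≡⟨ regroup′ c R s' P (k * c) g ⟩
    c + (R + P * (k * c + s')) * g            ≡⟨ cong (λ z → c + (R + P * z) * g) kc+s'≡ ⟩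
    c + (R + P * (a + s * g)) * g             ∎)
  where
  open ≡-Reasoning
  A = val g M
  R = val g (reverse M)
  P = g ^ length M
  regroup : ∀ c g r' x y → (c + g * r') + (x + y) * g ≡ c + ((x + r') + y) * g
  regroup = solve-∀
  regroup′ : ∀ c R s' P x g → c + ((R + s' * P) + P * x) * g ≡ c + (R + P * (x + s')) * g
  regroup′ = solve-∀

Bounded : ℕ → Node → Set
Bounded k start      = ⊤
Bounded k (node s r) = s < k × r < k

edge-bounded : ∀ {g k u c a v} → 0 < k → Bounded k u → Edge g k u c a v → Bounded k v
edge-bounded {u = start} {v = node _ _} 0<k _ ((_ , a<g , s'<k , _ , low) , _) = s'<k , carry<k a<g 0<k low
edge-bounded {u = node _ _} {v = node _ _} 0<k (_ , r<k) (_ , a<g , s'<k , _ , low) = s'<k , carry<k a<g r<k low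

path-bounded : ∀ {g k u v} → 0 < k → Bounded k u → Path g k u v → Bounded k v
path-bounded 0<k bu [] = bu
path-bounded 0<k bu (e ∷ p) = path-bounded 0<k (edge-bounded 0<k bu e) p

_▻_ : ∀ {g k u v c a w} → Path g k u v → Edge g k v c a w → Path g k u w
[] ▻ e = e ∷ []
(e′ ∷ p) ▻ e = e′ ∷ (p ▻ e)

Sol : ℕ → ℕ → Node → List ℕ → Set
Sol g k start      ds = IsRMDigits g k ds
Sol g k (node s r) ds = All (_< g) ds × CarryEq g k s r ds

sol-start⁻ : ∀ {g k ds} → Sol g k start ds → Sol g k (node 0 0) ds
sol-start⁻ (ds<g , _ , _ , kN≡rev) = ds<g , cong (_+ 0) kN≡rev

sol-start⁺ : ∀ {g k ds} → Sol g k (node 0 0) ds → HeadNZ (reverse ds) → HeadNZ ds → Sol g k start ds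
sol-start⁺ (ds<g , eq) last≢0 head≢0 = ds<g , last≢0 , head≢0 , +-cancelʳ-≡ 0 _ _ eq

sol-wrap⁻ : ∀ {g k u a M c} → 0 < k → Bounded k u → Sol g k u (wrap a M c) →
  ∃₂ λ s' r' → Edge g k u c a (node s' r') × Sol g k (node s' r') M
sol-wrap⁻ {u = node s r} 0<k (_ , r<k) (digits<g , eq) with All-wrap⁻ digits<g
... | a<g , M<g , c<g with carryEq-wrap⁻ {s = s} r<k a<g c<g M<g eq
... | s' , r' , step , eq′ = s' , r' , step , M<g , eq′
sol-wrap⁻ {k = k} {start} {a} {M} {c} 0<k _ sol@(_ , c≢0 , a≢0 , _)
  with sol-wrap⁻ {u = node 0 0} 0<k (0<k , 0<k) (sol-start⁻ {k = k} sol)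
... | s' , r' , step , sol′ = s' , r' , (step , a≢0 , subst HeadNZ (reverse-wrap a M c) c≢0) , sol′

sol-wrap⁺ : ∀ {g k u v a M c} → Edge g k u c a v → Sol g k v M → Sol g k u (wrap a M c)
sol-wrap⁺ {u = start} {start} ()
sol-wrap⁺ {u = node _ _} {start} ()
sol-wrap⁺ {g} {k} {node s r} {node s' r'} {a} {M} {c} step@(c<g , a<g , _) (M<g , eq) =
  All-wrap⁺ a<g M<g c<g , carryEq-wrap⁺ {g} {k} {s} {r} {a} {c} {M} {s'} {r'} step eq
sol-wrap⁺ {k = k} {start} {v@(node _ _)} {a} {M} {c} (step , a≢0 , c≢0) sol =
  sol-start⁺ {k = k} (sol-wrap⁺ {k = k} {node 0 0} {v} step sol)
    (subst HeadNZ (sym (reverse-wrap a M c)) c≢0) a≢0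

CarryEq-[] : ∀ g k s r → CarryEq g k s r [] ≡ (r ≡ s)
CarryEq-[] g k s r rewrite *-zeroʳ k | *-identityʳ s = refl

CarryEq-[_] : ∀ a g k s r → CarryEq g k s r [ a ] ≡ (k * a + r ≡ a + s * g)
CarryEq-[ a ] g k s r rewrite *-zeroʳ g | +-identityʳ a | *-identityʳ g = refl

sol-[]⁻ : ∀ {g k u} → Sol g k u [] → ∃ λ s → u ≡ node s s
sol-[]⁻ {u = start} (_ , () , _)
sol-[]⁻ {g} {k} {node s r} (_ , eq) = s , cong (node s) (subst id (CarryEq-[] g k s r) eq)

sol-[]⁺ : ∀ {g k s} → Sol g k (node s s) []
sol-[]⁺ {g} {k} {s} = [] , subst id (sym (CarryEq-[] g k s s)) refl

m*n≡n⇒n≡0 : ∀ {m n} → 1 < m → m * n ≡ n → n ≡ 0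
m*n≡n⇒n≡0 {n = zero} _ _ = refl
m*n≡n⇒n≡0 {m} {suc n} 1<m e =
  ⊥-elim (<⇒≢ 1<m (sym (*-cancelʳ-≡ m 1 (suc n) (trans e (sym (*-identityˡ (suc n)))))))

start-[_] : ∀ a {g k} → 1 < k → ¬ Sol g k start [ a ]
start-[ a ] 1<k (_ , _ , a≢0 , ka≡a) = a≢0 (m+n≡0⇒m≡0 a (m*n≡n⇒n≡0 1<k ka≡a))

sol-[_]⁻ : ∀ a {g k s r} → r < k → Sol g k (node s r) [ a ] → Edge g k (node s r) a a (node r s)
sol-[ a ]⁻ {g} {k} {s} {r} r<k (a<g ∷ [] , eq) =
  a<g , a<g , r<k , ka+r≡ , trans ka+r≡ (cong (λ z → a + z) (*-comm s g))
  where
  ka+r≡ : k * a + r ≡ a + s * g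
  ka+r≡ = subst id (CarryEq-[ a ] g k s r) eq

sol-[_]⁺ : ∀ a {g k s r} → Edge g k (node s r) a a (node r s) → Sol g k (node s r) [ a ]
sol-[ a ]⁺ {g} {k} {s} {r} (_ , a<g , _ , ka+r≡ , _) = a<g ∷ [] , subst id (sym (CarryEq-[ a ] g k s r)) ka+r≡

odd-pivot : ∀ {g k s r c a} → InH g k (node s r) → Edge g k (node s r) c a (node r s) → Pivot g k (node s r)
odd-pivot {s = s} {r} h e with s ≟ r
... | yes refl = inj₂ (h , inj₁ (refl , _ , _ , e))
... | no s≢r = inj₂ (h , inj₂ (s≢r , _ , _ , e))

sol⇒pivot : ∀ {g k u ds} → 1 < k → Shells ds → InH g k u → Sol g k u ds →
  ∃ λ w → Pivot g k w × Path g k u w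
sol⇒pivot 1<k empty h sol with sol-[]⁻ sol
... | s , refl = node s s , inj₁ (h , refl) , []
sol⇒pivot {u = start} 1<k (single a) h sol = ⊥-elim (start-[ a ] 1<k sol)
sol⇒pivot {u = node s r} 1<k (single a) h sol =
  node s r , odd-pivot h (sol-[ a ]⁻ (proj₂ (path-bounded (<-trans z<s 1<k) tt h)) sol) , []
sol⇒pivot 1<k (layer a c core) h sol with sol-wrap⁻ (<-trans z<s 1<k) (path-bounded (<-trans z<s 1<k) tt h) sol
... | s' , r' , e , sol′ with sol⇒pivot 1<k core (h ▻ e) sol′
... | w , pivot , p = w , pivot , e ∷ p

-- Two labels on the same edge that differ by d in the high digit differ by k d in the low digit, and then by
-- k² d in the high digit again; so k² d = d.
step-unique-≤ : ∀ {g k s r c a c' a' s' r'} → 1 < k → c ≤ c' →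
  Step g k s r c a s' r' → Step g k s r c' a' s' r' → c ≡ c' × a ≡ a'
step-unique-≤ {g} {k} {s} {r} {c} {a} {c'} {a'} {s'} {r'} 1<k c≤c'
  (_ , _ , _ , high , low) (_ , _ , _ , high' , low')
  with m≤n⇒∃[o]m+o≡n c≤c'
... | d , c+d≡c' = trans (sym (+-identityʳ c)) (trans (cong (λ z → c + z) (sym d≡0)) c+d≡c') ,
                   sym (trans a'≡a+kd (trans (cong (λ z → a + k * z) d≡0)
                     (trans (cong (λ z → a + z) (*-zeroʳ k)) (+-identityʳ a))))
  where
  open ≡-Reasoning
  a'≡a+kd : a' ≡ a + k * d
  a'≡a+kd = +-cancelʳ-≡ (s * g) _ _ (begin
    a' + s * g            ≡⟨ sym high' ⟩
    k * c' + s'           ≡⟨ cong (λ z → k * z + s') (sym c+d≡c') ⟩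
    k * (c + d) + s'      ≡⟨ expand₁ k c d s' ⟩
    (k * c + s') + k * d  ≡⟨ cong (_+ k * d) high ⟩
    (a + s * g) + k * d   ≡⟨ expand₂ a (s * g) (k * d) ⟩
    a + k * d + s * g     ∎)
    where
    expand₁ : ∀ k c d s' → k * (c + d) + s' ≡ (k * c + s') + k * d
    expand₁ = solve-∀
    expand₂ : ∀ a x y → (a + x) + y ≡ a + y + x
    expand₂ = solve-∀
  kkd≡d : k * k * d ≡ d
  kkd≡d = +-cancelˡ-≡ (c + g * r') _ _ (begin
    (c + g * r') + k * k * d  ≡⟨ cong (_+ k * k * d) (sym low) ⟩
    (k * a + r) + k * k * d   ≡⟨ expand₃ k a r d ⟩
    k * (a + k * d) + r       ≡⟨ cong (λ z → k * z + r) (sym a'≡a+kd) ⟩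
    k * a' + r                ≡⟨ low' ⟩
    c' + g * r'               ≡⟨ cong (_+ g * r') (sym c+d≡c') ⟩
    c + d + g * r'            ≡⟨ expand₂ c d (g * r') ⟩
    (c + g * r') + d          ∎)
    where
    expand₂ : ∀ a x y → (a + x) + y ≡ a + y + x
    expand₂ = solve-∀
    expand₃ : ∀ k a r d → (k * a + r) + k * k * d ≡ k * (a + k * d) + r
    expand₃ = solve-∀
  d≡0 : d ≡ 0
  d≡0 = m*n≡n⇒n≡0 (*-mono-< 1<k 1<k) kkd≡d

step-unique : ∀ {g k s r c a c' a' s' r'} → 1 < k → Step g k s r c a s' r' → Step g k s r c' a' s' r' →
  c ≡ c' × a ≡ a'
step-unique {s = s} {c = c} {c' = c'} 1<k st st' with ≤-total c c'
... | inj₁ c≤c' = step-unique-≤ {s = s} 1<k c≤c' st st'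
... | inj₂ c'≤c with step-unique-≤ {s = s} 1<k c'≤c st' st
...   | c'≡c , a'≡a = sym c'≡c , sym a'≡a

edge-unique : ∀ {g k u v c a c' a'} → 1 < k → Edge g k u c a v → Edge g k u c' a' v → c ≡ c' × a ≡ a'
edge-unique {u = start} {node _ _} 1<k (st , _) (st' , _) = step-unique {s = 0} 1<k st st'
edge-unique {u = node s _} {node _ _} 1<k st st' = step-unique {s = s} 1<k st st'

-- Counting and generating functions

unique-length : ∀ {A : Set} {xs ys : List A} → Unique xs → Unique ys → (∀ {z} → z ∈ xs ⇔ z ∈ ys) →
  length xs ≡ length ys
unique-length xs! ys! xs⇔ys = ↭-length (∼bag⇒↭ (unique∧set⇒bag xs! ys! xs⇔ys))

∈-lists⁻ : ∀ {g} t {ds} → ds ∈ lists g t → length ds ≡ t × All (_< g) ds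
∈-lists⁻ zero (here refl) = refl , []
∈-lists⁻ {g} (suc t) m with find (∈-concatMap⁻ (λ d → map (d ∷_) (lists g t)) {xs = upTo g} m)
... | d , d∈ , m′ with ∈-map⁻ (d ∷_) m′
... | ds′ , m″ , refl with ∈-lists⁻ t m″
... | len , ds′<g = cong suc len , ∈-upTo⁻ d∈ ∷ ds′<g

∈-lists⁺ : ∀ {g} t {ds} → length ds ≡ t → All (_< g) ds → ds ∈ lists g t
∈-lists⁺ zero {[]} refl [] = here refl
∈-lists⁺ {g} (suc t) {d ∷ ds} refl (d<g ∷ ds<g) =
  ∈-concatMap⁺ (λ d → map (d ∷_) (lists g t)) (lose (∈-upTo⁺ d<g) (∈-map⁺ (d ∷_) (∈-lists⁺ t refl ds<g)))

lists-unique : ∀ g t → Unique (lists g t)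
lists-unique g zero = [] ∷ []
lists-unique g (suc t) =
  Uniqueₚ.concat⁺ (Allₚ.map⁺ (All.universal (λ d → Uniqueₚ.map⁺ ∷-injectiveʳ (lists-unique g t)) (upTo g)))
                 (AllPairsₚ.map⁺ (AllPairs.map blocks-disjoint (Uniqueₚ.upTo⁺ g)))
  where
  blocks-disjoint : ∀ {d d′} → d ≢ d′ → Disjoint (map (d ∷_) (lists g t)) (map (d′ ∷_) (lists g t))
  blocks-disjoint d≢d′ (m , m′) with ∈-map⁻ _ m | ∈-map⁻ _ m′
  ... | _ , _ , refl | _ , _ , eq = d≢d′ (∷-injectiveˡ eq)

denominator numerator : Series
denominator = poly (+ 1 ∷ + 0 ∷ -[1+ 0 ] ∷ + 0 ∷ -[1+ 0 ] ∷ [])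
numerator = poly (+ 0 ∷ + 0 ∷ + 0 ∷ + 0 ∷ + 1 ∷ + 1 ∷ [])

sumℤ-∷ʳ : ∀ xs a → sumℤ (xs ++ [ a ]) ≡ sumℤ xs ℤ.+ a
sumℤ-∷ʳ [] a = trans (ℤₚ.+-identityʳ a) (sym (ℤₚ.+-identityˡ a))
sumℤ-∷ʳ (x ∷ xs) a = trans (cong (λ s → x ℤ.+ s) (sumℤ-∷ʳ xs a)) (sym (ℤₚ.+-assoc x (sumℤ xs) a))

Σ< : ℕ → (ℕ → ℤ) → ℤ
Σ< n F = sumℤ (map F (upTo n))

Σ<-suc : ∀ n F → Σ< (suc n) F ≡ Σ< n F ℤ.+ F n
Σ<-suc n F = begin
  sumℤ (map F (upTo (suc n)))         ≡⟨ cong (λ l → sumℤ (map F l)) (sym (upTo-∷ʳ n)) ⟩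
  sumℤ (map F (upTo n ++ [ n ]))      ≡⟨ cong sumℤ (map-++ F (upTo n) [ n ]) ⟩
  sumℤ (map F (upTo n) ++ [ F n ])    ≡⟨ sumℤ-∷ʳ (map F (upTo n)) (F n) ⟩
  Σ< n F ℤ.+ F n                      ∎
  where open ≡-Reasoning

Σ<-+ : ∀ n m F → Σ< (n + m) F ≡ Σ< m F ℤ.+ Σ< n (λ d → F (d + m))
Σ<-+ zero m F = sym (ℤₚ.+-identityʳ (Σ< m F))
Σ<-+ (suc n) m F = begin
  Σ< (suc n + m) F                                         ≡⟨ Σ<-suc (n + m) F ⟩
  Σ< (n + m) F ℤ.+ F (n + m)                               ≡⟨ cong (ℤ._+ F (n + m)) (Σ<-+ n m F) ⟩
  Σ< m F ℤ.+ Σ< n (λ d → F (d + m)) ℤ.+ F (n + m)            ≡⟨ ℤₚ.+-assoc (Σ< m F) _ _ ⟩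
  Σ< m F ℤ.+ (Σ< n (λ d → F (d + m)) ℤ.+ F (n + m))          ≡⟨ cong (λ s → Σ< m F ℤ.+ s) (sym (Σ<-suc n _)) ⟩
  Σ< m F ℤ.+ Σ< (suc n) (λ d → F (d + m))                    ∎
  where open ≡-Reasoning

Σ<-zero : ∀ n F → (∀ i → i < n → F i ≡ + 0) → Σ< n F ≡ + 0
Σ<-zero zero F _ = refl
Σ<-zero (suc n) F F≡0 = begin
  Σ< (suc n) F        ≡⟨ Σ<-suc n F ⟩
  Σ< n F ℤ.+ F n        ≡⟨ cong₂ ℤ._+_ (Σ<-zero n F (λ i i<n → F≡0 i (m<n⇒m<1+n i<n))) (F≡0 n ≤-refl) ⟩
  + 0                 ∎
  where open ≡-Reasoning

-- Only the last five terms f (d + m) · denominator (4 - d) of the convolution can be nonzero.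
⊛-denominator : ∀ (f : Series) m → (f ⊛ denominator) (4 + m) ≡ f (4 + m) ℤ.- f (2 + m) ℤ.- f m
⊛-denominator f m = begin
  Σ< (5 + m) F                                         ≡⟨ Σ<-+ 5 m F ⟩
  Σ< m F ℤ.+ Σ< 5 (λ d → F (d + m))
    ≡⟨ cong₂ ℤ._+_ Σ<m≡0 (cong sumℤ (map-cong last-five (upTo 5))) ⟩
  + 0 ℤ.+ Σ< 5 (λ d → f (d + m) ℤ.* denominator (4 ∸ d))
    ≡⟨ collect (f m) (f (1 + m)) (f (2 + m)) (f (3 + m)) (f (4 + m)) ⟩
  f (4 + m) ℤ.- f (2 + m) ℤ.- f m                         ∎
  where
  open ≡-Reasoning
  F : ℕ → ℤ
  F i = f i ℤ.* denominator (4 + m ∸ i)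
  beyond : ∀ m i → i < m → 4 + m ∸ i ≡ 5 + (m ∸ suc i)
  beyond (suc m) zero _ = refl
  beyond (suc m) (suc i) (s<s i<m) = beyond m i i<m
  Σ<m≡0 : Σ< m F ≡ + 0
  Σ<m≡0 = Σ<-zero m F (λ i i<m → trans (cong (λ z → f i ℤ.* denominator z) (beyond m i i<m)) (ℤₚ.*-zeroʳ (f i)))
  last-five : ∀ d → F (d + m) ≡ f (d + m) ℤ.* denominator (4 ∸ d)
  last-five d = cong (λ z → f (d + m) ℤ.* denominator z)
                     (trans (cong₂ _∸_ (+-comm 4 m) (+-comm d m)) ([m+n]∸[m+o]≡n∸o m 4 d))
  collect : ∀ a b c d e →
    + 0 ℤ.+ (a ℤ.* -[1+ 0 ] ℤ.+ (b ℤ.* + 0 ℤ.+ (c ℤ.* -[1+ 0 ] ℤ.+ (d ℤ.* + 0 ℤ.+ (e ℤ.* + 1 ℤ.+ + 0)))))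
    ≡ e ℤ.- c ℤ.- a
  collect = ℤ-Solver.solve-∀

-- With c₀ = c₁ = 0 and c (n + 2) = F ⌊n/2⌋, the recurrence of F makes c · (1 - x² - x⁴) collapse to x⁴ + x⁵.
generating-function : ∀ (c : ℕ → ℕ) → c 0 ≡ 0 → c 1 ≡ 0 → (∀ n → c (2 + n) ≡ fib ⌊ n /2⌋) →
  ∀ n → ((λ t → + c t) ⊛ denominator) n ≡ numerator n
generating-function c c₀ c₁ c₂₊ 0 rewrite c₀ = refl
generating-function c c₀ c₁ c₂₊ 1 rewrite c₀ | c₁ = refl
generating-function c c₀ c₁ c₂₊ 2 rewrite c₀ | c₁ | c₂₊ 0 = refl
generating-function c c₀ c₁ c₂₊ 3 rewrite c₀ | c₁ | c₂₊ 0 | c₂₊ 1 = refl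
generating-function c c₀ c₁ c₂₊ (suc (suc (suc (suc m)))) = trans (⊛-denominator (λ t → + c t) m) (tail m)
  where
  fib-step : ∀ x y → + (x + y) ℤ.- + x ℤ.- + y ≡ + 0
  fib-step x y rewrite ℤₚ.pos-+ x y = cancel (+ x) (+ y)
    where
    cancel : ∀ a b → a ℤ.+ b ℤ.- a ℤ.- b ≡ + 0
    cancel = ℤ-Solver.solve-∀
  tail : ∀ m → + c (4 + m) ℤ.- + c (2 + m) ℤ.- + c m ≡ numerator (4 + m)
  tail 0 rewrite c₂₊ 2 | c₂₊ 0 | c₀ = refl
  tail 1 rewrite c₂₊ 3 | c₂₊ 1 | c₁ = refl
  tail (suc (suc m)) rewrite c₂₊ (4 + m) | c₂₊ (2 + m) | c₂₊ m = fib-step (fib (suc ⌊ m /2⌋)) (fib ⌊ m /2⌋)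

⌊n/2⌋≡n/2 : ∀ n → ⌊ n /2⌋ ≡ n / 2
⌊n/2⌋≡n/2 zero = refl
⌊n/2⌋≡n/2 (suc zero) = refl
⌊n/2⌋≡n/2 (suc (suc n)) = trans (cong suc (⌊n/2⌋≡n/2 n)) (sym (m/n≡1+[m∸n]/n {2 + n} {2} (s≤s (s≤s z≤n))))

-- Bit words

Bit : ℕ → Set
Bit d = d ≡ 0 ⊎ d ≡ 1

NoSingle : ℕ → ℕ → ℕ → Set
NoSingle x y z = x ≡ y ⊎ z ≡ y

Windows : List ℕ → Set
Windows (x ∷ y ∷ z ∷ ws) = NoSingle x y z × Windows (y ∷ z ∷ ws)
Windows _ = ⊤

Palindrome : List ℕ → Set
Palindrome ws = ws ≡ reverse ws

NoSingle-sym : ∀ {x y z} → NoSingle x y z → NoSingle z y x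
NoSingle-sym (inj₁ x≡y) = inj₂ x≡y
NoSingle-sym (inj₂ z≡y) = inj₁ z≡y

Windows-∷ʳ : ∀ ws x y z → Windows (ws ++ x ∷ y ∷ []) → NoSingle x y z → Windows (ws ++ x ∷ y ∷ z ∷ [])
Windows-∷ʳ [] x y z _ xyz = xyz , tt
Windows-∷ʳ (a ∷ []) x y z (axy , _) xyz = axy , xyz , tt
Windows-∷ʳ (a ∷ b ∷ []) x y z (abx , bxy , _) xyz = abx , bxy , xyz , tt
Windows-∷ʳ (a ∷ b ∷ c ∷ ws) x y z (abc , rest) xyz = abc , Windows-∷ʳ (b ∷ c ∷ ws) x y z rest xyz

Windows-init : ∀ ws x → Windows (ws ∷ʳ x) → Windows ws
Windows-init [] x _ = tt
Windows-init (a ∷ []) x _ = tt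
Windows-init (a ∷ b ∷ []) x _ = tt
Windows-init (a ∷ b ∷ c ∷ ws) x (abc , rest) = abc , Windows-init (b ∷ c ∷ ws) x rest

Windows-tail : ∀ x ws → Windows (x ∷ ws) → Windows ws
Windows-tail x [] _ = tt
Windows-tail x (y ∷ []) _ = tt
Windows-tail x (y ∷ z ∷ ws) (_ , rest) = rest

palindrome-wrap⁻ : ∀ {a M c} → Palindrome (wrap a M c) → a ≡ c × Palindrome M
palindrome-wrap⁻ {a} {M} {c} pal with trans pal (reverse-wrap a M c)
... | eq = ∷-injectiveˡ eq , proj₁ (∷ʳ-injective M (reverse M) (∷-injectiveʳ eq))

palindrome-wrap⁺ : ∀ {a M} → Palindrome M → Palindrome (wrap a M a)
palindrome-wrap⁺ {a} {M} pal = trans (cong (λ N → wrap a N a) pal) (sym (reverse-wrap a M a))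

palindrome-ends : ∀ {q r R} → Palindrome (q ∷ r ∷ R) → q ∷ r ∷ R ≡ reverse R ++ r ∷ q ∷ []
palindrome-ends {q} {r} {R} pal = trans pal (reverse-++ (q ∷ r ∷ []) R)

Windows-∷ʳ-palindrome : ∀ {q r R p} → Palindrome (q ∷ r ∷ R) → Windows (q ∷ r ∷ R) → NoSingle r q p →
  Windows ((q ∷ r ∷ R) ∷ʳ p)
Windows-∷ʳ-palindrome {q} {r} {R} {p} pal windows rqp = subst Windows shape
  (Windows-∷ʳ (reverse R) r q p (subst Windows (palindrome-ends pal) windows) rqp)
  where
  shape : reverse R ++ r ∷ q ∷ p ∷ [] ≡ (q ∷ r ∷ R) ∷ʳ p
  shape = trans (sym (++-assoc (reverse R) (r ∷ q ∷ []) [ p ])) (cong (_∷ʳ p) (sym (palindrome-ends pal)))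

-- nth reads 0 beyond the end of the list, which is exactly the padding of a multiplier by zeros.
nth : List ℕ → ℕ → ℕ
nth [] _ = 0
nth (x ∷ _) zero = x
nth (_ ∷ xs) (suc i) = nth xs i

lookup≡nth : ∀ xs (i : Fin (length xs)) → lookup xs i ≡ nth xs (toℕ i)
lookup≡nth (x ∷ xs) fzero = refl
lookup≡nth (x ∷ xs) (fsuc i) = lookup≡nth xs i

nth-beyond : ∀ xs i → length xs ≤ i → nth xs i ≡ 0
nth-beyond [] i _ = refl
nth-beyond (x ∷ xs) (suc i) (s≤s ≤i) = nth-beyond xs i ≤i

nth-∷ʳ : ∀ xs x → nth (xs ∷ʳ x) (length xs) ≡ x
nth-∷ʳ [] x = refl
nth-∷ʳ (_ ∷ xs) x = nth-∷ʳ xs x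

pad : List ℕ → List ℕ
pad β = 0 ∷ 0 ∷ β ++ 0 ∷ 0 ∷ []

nth-pad : ∀ β i → nth (pad β) (2 + i) ≡ nth β i
nth-pad [] zero = refl
nth-pad [] (suc zero) = refl
nth-pad [] (suc (suc i)) = refl
nth-pad (x ∷ β) zero = refl
nth-pad (x ∷ β) (suc i) = nth-pad β i

length-pad : ∀ β → length (pad β) ≡ 4 + length β
length-pad β = cong (λ z → 2 + z) (trans (length-++ β) (+-comm (length β) 2))

Windows⇒nth : ∀ ws p → Windows ws → 2 + p < length ws → NoSingle (nth ws p) (nth ws (1 + p)) (nth ws (2 + p))
Windows⇒nth (x ∷ y ∷ z ∷ ws) zero (xyz , _) _ = xyz
Windows⇒nth (x ∷ y ∷ z ∷ ws) (suc p) (_ , rest) (s≤s lt) = Windows⇒nth (y ∷ z ∷ ws) p rest lt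
Windows⇒nth (x ∷ []) zero _ (s≤s ())
Windows⇒nth (x ∷ y ∷ []) zero _ (s≤s (s≤s ()))
Windows⇒nth (x ∷ y ∷ []) (suc p) _ (s≤s (s≤s ()))

nth⇒Windows : ∀ ws → (∀ p → 2 + p < length ws → NoSingle (nth ws p) (nth ws (1 + p)) (nth ws (2 + p))) →
  Windows ws
nth⇒Windows [] _ = tt
nth⇒Windows (x ∷ []) _ = tt
nth⇒Windows (x ∷ y ∷ []) _ = tt
nth⇒Windows (x ∷ y ∷ z ∷ ws) all =
  all 0 (s≤s (s≤s (s≤s z≤n))) , nth⇒Windows (y ∷ z ∷ ws) (λ p lt → all (suc p) (s≤s lt))

last-palindrome : ∀ ws → Palindrome ws → nth ws (pred (length ws)) ≡ nth ws 0
last-palindrome ws pal with initLast ws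
... | [] = refl
... | M ∷ʳ′ l = begin
  nth (M ∷ʳ l) (pred (length (M ∷ʳ l))) ≡⟨ cong (λ n → nth (M ∷ʳ l) (pred n)) (length-∷ʳ M l) ⟩
  nth (M ∷ʳ l) (length M)            ≡⟨ nth-∷ʳ M l ⟩
  l                                  ≡⟨ cong (λ w → nth w 0) (sym (trans pal (reverse-++ M [ l ]))) ⟩
  nth (M ∷ʳ l) 0                     ∎
  where open ≡-Reasoning

lookup-fromℕ< : ∀ β {i} (i<m : i < length β) → lookup β (fromℕ< i<m) ≡ nth β i
lookup-fromℕ< β i<m = trans (lookup≡nth β (fromℕ< i<m)) (cong (nth β) (toℕ-fromℕ< i<m))

noSingles⇒windows : ∀ β → NoSingles β → Windows (pad β)
noSingles⇒windows β noSingles = nth⇒Windows (pad β) window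
  where
  open ≡-Reasoning
  window : ∀ p → 2 + p < length (pad β) → NoSingle (nth (pad β) p) (nth (pad β) (1 + p)) (nth (pad β) (2 + p))
  window zero _ = inj₁ refl
  window (suc i) _ with i <? length β
  ... | no i≮m = inj₂ (begin
    nth (pad β) (3 + i)  ≡⟨ nth-pad β (1 + i) ⟩
    nth β (1 + i)        ≡⟨ nth-beyond β (1 + i) (m≤n⇒m≤1+n (≮⇒≥ i≮m)) ⟩
    0                    ≡⟨ sym (nth-beyond β i (≮⇒≥ i≮m)) ⟩
    nth β i              ≡⟨ sym (nth-pad β i) ⟩
    nth (pad β) (2 + i)  ∎)
  ... | yes i<m with noSingles (fromℕ< i<m)
  ...   | j , inj₁ j≡1+i , βj≡βi = inj₂ (begin
    nth (pad β) (3 + i)       ≡⟨ nth-pad β (1 + i) ⟩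
    nth β (1 + i)             ≡⟨ cong (λ n → nth β (1 + n)) (sym (toℕ-fromℕ< i<m)) ⟩
    nth β (1 + toℕ (fromℕ< i<m)) ≡⟨ cong (nth β) (sym j≡1+i) ⟩
    nth β (toℕ j)             ≡⟨ sym (lookup≡nth β j) ⟩
    lookup β j                ≡⟨ βj≡βi ⟩
    lookup β (fromℕ< i<m)     ≡⟨ lookup-fromℕ< β i<m ⟩
    nth β i                   ≡⟨ sym (nth-pad β i) ⟩
    nth (pad β) (2 + i)       ∎)
  ...   | j , inj₂ i≡1+j , βj≡βi = inj₁ (begin
    nth (pad β) (1 + i)       ≡⟨ cong (λ n → nth (pad β) (1 + n)) (trans (sym (toℕ-fromℕ< i<m)) i≡1+j) ⟩
    nth (pad β) (2 + toℕ j)   ≡⟨ nth-pad β (toℕ j) ⟩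
    nth β (toℕ j)             ≡⟨ sym (lookup≡nth β j) ⟩
    lookup β j                ≡⟨ βj≡βi ⟩
    lookup β (fromℕ< i<m)     ≡⟨ lookup-fromℕ< β i<m ⟩
    nth β i                   ≡⟨ sym (nth-pad β i) ⟩
    nth (pad β) (2 + i)       ∎)

-- Here the padding zeros act as neighbours, so the outer bits of β must be 1.
windows⇒noSingles : ∀ β → nth β 0 ≡ 1 → Palindrome β → Windows (pad β) → NoSingles β
windows⇒noSingles β first≡1 pal windows i = neighbour (window (toℕ i) (toℕ<n i))
  where
  open ≡-Reasoning
  m = length β
  window : ∀ k → k < m → NoSingle (nth (pad β) (1 + k)) (nth β k) (nth β (1 + k))
  window k k<m = subst₂ (NoSingle (nth (pad β) (1 + k))) (nth-pad β k) (nth-pad β (1 + k))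
    (Windows⇒nth (pad β) (1 + k) windows
      (subst (3 + k <_) (sym (length-pad β)) (s≤s (s≤s (s≤s (m≤n⇒m≤1+n k<m))))))
  lookup-i : lookup β i ≡ nth β (toℕ i)
  lookup-i = lookup≡nth β i
  neighbour : NoSingle (nth (pad β) (1 + toℕ i)) (nth β (toℕ i)) (nth β (1 + toℕ i)) →
    ∃ λ (j : Fin m) → (toℕ j ≡ suc (toℕ i) ⊎ toℕ i ≡ suc (toℕ j)) × lookup β j ≡ lookup β i
  neighbour (inj₁ left) = left-neighbour (toℕ i) refl left
    where
    left-neighbour : ∀ k → k ≡ toℕ i → nth (pad β) (1 + k) ≡ nth β k →
      ∃ λ (j : Fin m) → (toℕ j ≡ suc (toℕ i) ⊎ toℕ i ≡ suc (toℕ j)) × lookup β j ≡ lookup β i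
    left-neighbour zero _ 0≡first = ⊥-elim (0≢1+n (trans 0≡first first≡1))
    left-neighbour (suc k) k≡i same =
      fromℕ< k<m , inj₂ (trans (sym k≡i) (cong suc (sym (toℕ-fromℕ< k<m)))) , (begin
      lookup β (fromℕ< k<m)     ≡⟨ lookup-fromℕ< β k<m ⟩
      nth β k                   ≡⟨ sym (nth-pad β k) ⟩
      nth (pad β) (2 + k)       ≡⟨ same ⟩
      nth β (suc k)             ≡⟨ cong (nth β) k≡i ⟩
      nth β (toℕ i)             ≡⟨ sym lookup-i ⟩
      lookup β i                ∎)
      where
      k<m : k < m
      k<m = <-trans (n<1+n k) (subst (_< m) (sym k≡i) (toℕ<n i))
  neighbour (inj₂ right) with suc (toℕ i) <? m
  ... | yes 1+i<m = fromℕ< 1+i<m , inj₁ (toℕ-fromℕ< 1+i<m) ,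
                    trans (lookup-fromℕ< β 1+i<m) (trans right (sym lookup-i))
  ... | no 1+i≮m = ⊥-elim (0≢1+n (begin
    0                   ≡⟨ sym (nth-beyond β (suc (toℕ i)) (≮⇒≥ 1+i≮m)) ⟩
    nth β (suc (toℕ i)) ≡⟨ right ⟩
    nth β (toℕ i)       ≡⟨ cong (nth β) i≡m-1 ⟩
    nth β (pred m)      ≡⟨ last-palindrome β pal ⟩
    nth β 0             ≡⟨ first≡1 ⟩
    1                   ∎))
    where
    i≡m-1 : toℕ i ≡ pred m
    i≡m-1 = cong pred (≤-antisym (toℕ<n i) (≮⇒≥ 1+i≮m))

-- The 1089 graph

-- k = j + 2, b = b' + 1 and g = b (k + 1) is the shape forced by 2 ≤ k and k + 1 ∣ g.
module Young1089 (j b' : ℕ) where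

  k b g : ℕ
  k = 2 + j
  b = suc b'
  g = b * suc k

  1<k : 1 < k
  1<k = s≤s (s≤s z≤n)

  ⟦_⟧ : V1089 → Node
  ⟦ S ⟧ = start
  ⟦ U ⟧ = node 0 0
  ⟦ V ⟧ = node 0 (k ∸ 1)
  ⟦ W ⟧ = node (k ∸ 1) (k ∸ 1)
  ⟦ X ⟧ = node (k ∸ 1) 0

  -- U, V, W, X stand for the bit pairs 00, 01, 11, 10, and the edges of the 1089 graph are exactly the
  -- transitions pq → qr that do not isolate q; S is the 00 in front of the multiplier.
  bit₁ bit₂ : V1089 → ℕ
  bit₁ S = 0
  bit₁ U = 0
  bit₁ V = 0
  bit₁ W = 1
  bit₁ X = 1
  bit₂ S = 0
  bit₂ U = 0
  bit₂ V = 1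
  bit₂ W = 1
  bit₂ X = 0

  -- φ x y z is the digit of b (g² - 1) β at a place where β has the bit x, the place below it y and the one
  -- below that z: it equals k b x + b z - y.  The windows 010 and 101 never occur.
  φ : ℕ → ℕ → ℕ → ℕ
  φ 1 0 0 = k * b
  φ 1 1 0 = k * b ∸ 1
  φ 1 1 1 = g ∸ 1
  φ 0 1 1 = b ∸ 1
  φ 0 0 1 = b
  φ _ _ _ = 0

  high low : ∀ {x y} → E1089 x y → ℕ
  high {x} {y} _ = φ (bit₁ x) (bit₁ y) (bit₂ y)
  low  {x} {y} _ = φ (bit₂ y) (bit₁ y) (bit₁ x)

  g≡kb+b : g ≡ k * b + b
  g≡kb+b = expand j b
    where
    expand : ∀ j b → b * (3 + j) ≡ (2 + j) * b + b
    expand = solve-∀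

  kb<g : k * b < g
  kb<g = subst (k * b <_) (sym g≡kb+b) (m<m+n (k * b) z<s)

  b<g : b < g
  b<g = subst (b <_) (sym g≡kb+b) (m<n+m b z<s)

  realize : ∀ {x y} (e : E1089 x y) → Edge g k ⟦ x ⟧ (high e) (low e) ⟦ y ⟧
  realize SV = realize UV , (λ ()) , (λ ())
  realize UU = z<s , z<s , z<s , identity₁ j , identity₂ j b'
    where
    identity₁ : ∀ j → (2 + j) * 0 + 0 ≡ 0 + 0
    identity₁ = solve-∀
    identity₂ : ∀ j b' → (2 + j) * 0 + 0 ≡ 0 + (1 + b') * (3 + j) * 0
    identity₂ = solve-∀
  realize UV = b<g , kb<g , z<s , refl , identity j b'
    where
    identity : ∀ j b' → (2 + j) * ((2 + j) * (1 + b')) + 0 ≡ (1 + b') + (1 + b') * (3 + j) * (1 + j)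
    identity = solve-∀
  realize VW = ≤-<-trans (n≤1+n b') b<g , ≤-<-trans (n≤1+n _) kb<g , ≤-refl , identity₁ j b' , identity₂ j b'
    where
    identity₁ : ∀ j b' → (2 + j) * b' + (1 + j) ≡ (b' + (1 + j) * (1 + b')) + 0
    identity₁ = solve-∀
    identity₂ : ∀ j b' → (2 + j) * (b' + (1 + j) * (1 + b')) + (1 + j) ≡ b' + (1 + b') * (3 + j) * (1 + j)
    identity₂ = solve-∀
  realize WW = ≤-refl , ≤-refl , ≤-refl , identity₁ j b' , identity₂ j b'
    where
    identity₁ : ∀ j b' → (2 + j) * ((2 + j) + b' * (3 + j)) + (1 + j)
                       ≡ ((2 + j) + b' * (3 + j)) + (1 + j) * ((1 + b') * (3 + j))
    identity₁ = solve-∀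
    identity₂ : ∀ j b' → (2 + j) * ((2 + j) + b' * (3 + j)) + (1 + j)
                       ≡ ((2 + j) + b' * (3 + j)) + (1 + b') * (3 + j) * (1 + j)
    identity₂ = solve-∀
  realize WX = ≤-<-trans (n≤1+n _) kb<g , ≤-<-trans (n≤1+n b') b<g , ≤-refl , identity₁ j b' , identity₂ j b'
    where
    identity₁ : ∀ j b' → (2 + j) * (b' + (1 + j) * (1 + b')) + (1 + j) ≡ b' + (1 + j) * ((1 + b') * (3 + j))
    identity₁ = solve-∀
    identity₂ : ∀ j b' → (2 + j) * b' + (1 + j) ≡ (b' + (1 + j) * (1 + b')) + (1 + b') * (3 + j) * 0
    identity₂ = solve-∀
  realize XU = kb<g , b<g , z<s , identity₁ j b' , identity₂ j b'
    where
    identity₁ : ∀ j b' → (2 + j) * ((2 + j) * (1 + b')) + 0 ≡ (1 + b') + (1 + j) * ((1 + b') * (3 + j))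
    identity₁ = solve-∀
    identity₂ : ∀ j b' → (2 + j) * (1 + b') + 0 ≡ (2 + j) * (1 + b') + (1 + b') * (3 + j) * 0
    identity₂ = solve-∀

  ⟦W⟧≢⟦X⟧ : ⟦ W ⟧ ≢ ⟦ X ⟧
  ⟦W⟧≢⟦X⟧ ()

  infixr 5 _⇒_
  _⇒_ : ∀ {x y w} (e : E1089 x y) → Path g k ⟦ y ⟧ w → Path g k ⟦ x ⟧ w
  e ⇒ p = _∷_ {c = high e} {a = low e} (realize e) p

  inH : ∀ x → InH g k ⟦ x ⟧
  inH S = []
  inH U = SV ⇒ VW ⇒ WX ⇒ XU ⇒ []
  inH V = SV ⇒ []
  inH W = SV ⇒ VW ⇒ []
  inH X = SV ⇒ VW ⇒ WX ⇒ []

  inY : ∀ x → InY g k ⟦ x ⟧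
  inY S = inH S , ⟦ W ⟧ , inj₁ (inH W , refl) , SV ⇒ VW ⇒ []
  inY U = inH U , ⟦ U ⟧ , inj₁ (inH U , refl) , []
  inY V = inH V , ⟦ W ⟧ , inj₁ (inH W , refl) , VW ⇒ []
  inY W = inH W , ⟦ W ⟧ , inj₁ (inH W , refl) , []
  inY X = inH X , ⟦ U ⟧ , inj₁ (inH U , refl) , XU ⇒ []

  outer : ∀ {x y} → E1089 x y → List (List ℕ) → List (List ℕ)
  outer e = map (λ M → wrap (low e) M (high e))

  -- the labels read along the walks from x to a pivot of the 1089 graph; sound and complete show that
  -- these are the solutions of length n at ⟦ x ⟧
  solutions : V1089 → ℕ → List (List ℕ)
  solutions U zero = [ [] ]
  solutions W zero = [ [] ]
  solutions U (suc zero) = [ [ 0 ] ]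
  solutions W (suc zero) = [ [ g ∸ 1 ] ]
  solutions S (suc (suc n)) = outer SV (solutions V n)
  solutions U (suc (suc n)) = outer UU (solutions U n) ++ outer UV (solutions V n)
  solutions V (suc (suc n)) = outer VW (solutions W n)
  solutions W (suc (suc n)) = outer WW (solutions W n) ++ outer WX (solutions X n)
  solutions X (suc (suc n)) = outer XU (solutions U n)
  solutions _ _ = []

  ∈-solutions⁻ : ∀ x n {M} → M ∈ solutions x (2 + n) →
    ∃₂ λ y (e : E1089 x y) → ∃ λ M′ → M′ ∈ solutions y n × M ≡ wrap (low e) M′ (high e)
  ∈-solutions⁻ S n m = V , SV , ∈-map⁻ _ m
  ∈-solutions⁻ U n m with ∈-++⁻ (outer UU (solutions U n)) m
  ... | inj₁ m′ = U , UU , ∈-map⁻ _ m′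
  ... | inj₂ m′ = V , UV , ∈-map⁻ _ m′
  ∈-solutions⁻ V n m = W , VW , ∈-map⁻ _ m
  ∈-solutions⁻ W n m with ∈-++⁻ (outer WW (solutions W n)) m
  ... | inj₁ m′ = W , WW , ∈-map⁻ _ m′
  ... | inj₂ m′ = X , WX , ∈-map⁻ _ m′
  ∈-solutions⁻ X n m = U , XU , ∈-map⁻ _ m

  ∈-solutions⁺ : ∀ {x y n M} (e : E1089 x y) → M ∈ solutions y n → wrap (low e) M (high e) ∈ solutions x (2 + n)
  ∈-solutions⁺ SV m = ∈-map⁺ _ m
  ∈-solutions⁺ UU m = ∈-++⁺ˡ (∈-map⁺ _ m)
  ∈-solutions⁺ {n = n} UV m = ∈-++⁺ʳ (outer UU (solutions U n)) (∈-map⁺ _ m)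
  ∈-solutions⁺ VW m = ∈-map⁺ _ m
  ∈-solutions⁺ WW m = ∈-++⁺ˡ (∈-map⁺ _ m)
  ∈-solutions⁺ {n = n} WX m = ∈-++⁺ʳ (outer WW (solutions W n)) (∈-map⁺ _ m)
  ∈-solutions⁺ XU m = ∈-map⁺ _ m

  sound : ∀ x n {M} → M ∈ solutions x n → Sol g k ⟦ x ⟧ M
  sound U zero (here refl) = sol-[]⁺ {g} {k} {0}
  sound W zero (here refl) = sol-[]⁺ {g} {k} {k ∸ 1}
  sound U (suc zero) (here refl) = sol-[ 0 ]⁺ {g} {k} {0} {0} (realize UU)
  sound W (suc zero) (here refl) = sol-[ g ∸ 1 ]⁺ {g} {k} {k ∸ 1} {k ∸ 1} (realize WW)
  sound x (suc (suc n)) m with ∈-solutions⁻ x n m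
  ... | y , e , M′ , m′ , refl = sol-wrap⁺ (realize e) (sound y n m′)

  length-outer : ∀ {x y} (e : E1089 x y) Ms → length (outer e Ms) ≡ length Ms
  length-outer e = length-map _

  outer-unique : ∀ {x y Ms} (e : E1089 x y) → Unique Ms → Unique (outer e Ms)
  outer-unique e = Uniqueₚ.map⁺ wrap-injective

  outer-disjoint : ∀ {x y y′ Ms Ms′} (e : E1089 x y) (e′ : E1089 x y′) → low e ≢ low e′ →
    Disjoint (outer e Ms) (outer e′ Ms′)
  outer-disjoint e e′ low≢ (m , m′) with ∈-map⁻ _ m | ∈-map⁻ _ m′
  ... | _ , _ , refl | _ , _ , eq = low≢ (∷-injectiveˡ eq)

  g-1≢b-1 : g ∸ 1 ≢ b'
  g-1≢b-1 eq = <⇒≢ (≤-<-trans (m≤m*n b' (3 + j)) (m<n+m (b' * (3 + j)) z<s)) (sym eq)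

  solutions-unique : ∀ x n → Unique (solutions x n)
  solutions-unique U zero = [] ∷ []
  solutions-unique W zero = [] ∷ []
  solutions-unique U (suc zero) = [] ∷ []
  solutions-unique W (suc zero) = [] ∷ []
  solutions-unique S (suc (suc n)) = outer-unique SV (solutions-unique V n)
  solutions-unique U (suc (suc n)) =
    Uniqueₚ.++⁺ (outer-unique UU (solutions-unique U n)) (outer-unique UV (solutions-unique V n))
                (outer-disjoint UU UV (λ ()))
  solutions-unique V (suc (suc n)) = outer-unique VW (solutions-unique W n)
  solutions-unique W (suc (suc n)) =
    Uniqueₚ.++⁺ (outer-unique WW (solutions-unique W n)) (outer-unique WX (solutions-unique X n))
                (outer-disjoint WW WX g-1≢b-1)
  solutions-unique X (suc (suc n)) = outer-unique XU (solutions-unique U n)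
  solutions-unique S zero = []
  solutions-unique S (suc zero) = []
  solutions-unique V zero = []
  solutions-unique V (suc zero) = []
  solutions-unique X zero = []
  solutions-unique X (suc zero) = []

  solutions-length : ∀ n → length (solutions U n) ≡ fib (suc ⌊ n /2⌋) × length (solutions V n) ≡ fib ⌊ n /2⌋ ×
                           length (solutions W n) ≡ fib (suc ⌊ n /2⌋) × length (solutions X n) ≡ fib ⌊ n /2⌋
  solutions-length zero = refl , refl , refl , refl
  solutions-length (suc zero) = refl , refl , refl , refl
  solutions-length (suc (suc n)) with solutions-length n
  ... | |U| , |V| , |W| , |X| =
    trans (length-++ (outer UU (solutions U n)))
          (cong₂ _+_ (trans (length-outer UU (solutions U n)) |U|) (trans (length-outer UV (solutions V n)) |V|)) ,
    trans (length-outer VW (solutions W n)) |W| ,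
    trans (length-++ (outer WW (solutions W n)))
          (cong₂ _+_ (trans (length-outer WW (solutions W n)) |W|) (trans (length-outer WX (solutions X n)) |X|)) ,
    trans (length-outer XU (solutions U n)) |U|

  wrap∈solutions : ∀ {x y M a c} (e : E1089 x y) → c ≡ high e → a ≡ low e →
    M ∈ solutions y (length M) → wrap a M c ∈ solutions x (length (wrap a M c))
  wrap∈solutions {M = M} e refl refl m rewrite length-wrap (low e) M (high e) = ∈-solutions⁺ e m

  ∈-solutions⇒length : ∀ x n {M} → M ∈ solutions x n → length M ≡ n
  ∈-solutions⇒length U zero (here refl) = refl
  ∈-solutions⇒length W zero (here refl) = refl
  ∈-solutions⇒length U (suc zero) (here refl) = refl
  ∈-solutions⇒length W (suc zero) (here refl) = refl
  ∈-solutions⇒length x (suc (suc n)) m with ∈-solutions⁻ x n m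
  ... | y , e , M′ , m′ , refl =
    trans (length-wrap (low e) M′ (high e)) (cong (λ z → 2 + z) (∈-solutions⇒length y n m′))

  digits : List ℕ → List ℕ
  digits (z ∷ y ∷ x ∷ ws) = φ x y z ∷ digits (y ∷ x ∷ ws)
  digits _ = []

  digits-∷ʳ : ∀ ws z y x → digits (ws ++ z ∷ y ∷ x ∷ []) ≡ digits (ws ++ z ∷ y ∷ []) ∷ʳ φ x y z
  digits-∷ʳ [] z y x = refl
  digits-∷ʳ (a ∷ []) z y x = refl
  digits-∷ʳ (a ∷ a′ ∷ []) z y x = refl
  digits-∷ʳ (a ∷ a′ ∷ a″ ∷ ws) z y x = cong (φ a″ a′ a ∷_) (digits-∷ʳ (a′ ∷ a″ ∷ ws) z y x)

  digits-wrap : ∀ p q r R R′ → q ∷ r ∷ R ≡ R′ ++ r ∷ q ∷ [] →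
    digits (wrap p (q ∷ r ∷ R) p) ≡ wrap (φ r q p) (digits (q ∷ r ∷ R)) (φ p q r)
  digits-wrap p q r R R′ ends = cong (φ r q p ∷_) (begin
    digits ((q ∷ r ∷ R) ∷ʳ p)                ≡⟨ cong (λ ws → digits (ws ∷ʳ p)) ends ⟩
    digits ((R′ ++ r ∷ q ∷ []) ∷ʳ p)         ≡⟨ cong digits (++-assoc R′ (r ∷ q ∷ []) [ p ]) ⟩
    digits (R′ ++ r ∷ q ∷ p ∷ [])            ≡⟨ digits-∷ʳ R′ r q p ⟩
    digits (R′ ++ r ∷ q ∷ []) ∷ʳ φ p q r     ≡⟨ cong (λ ws → digits ws ∷ʳ φ p q r) (sym ends) ⟩
    digits (q ∷ r ∷ R) ∷ʳ φ p q r            ∎)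
    where open ≡-Reasoning

  Good : V1089 → List ℕ → Set
  Good x ws = All Bit ws × Palindrome ws × Windows ws × ∃ λ R → ws ≡ bit₁ x ∷ bit₂ x ∷ R

  bit₁-bit : ∀ x → Bit (bit₁ x)
  bit₁-bit S = inj₁ refl
  bit₁-bit U = inj₁ refl
  bit₁-bit V = inj₁ refl
  bit₁-bit W = inj₂ refl
  bit₁-bit X = inj₂ refl

  edge-overlap : ∀ {x y} → E1089 x y → bit₂ x ≡ bit₁ y
  edge-overlap SV = refl
  edge-overlap UU = refl
  edge-overlap UV = refl
  edge-overlap VW = refl
  edge-overlap WW = refl
  edge-overlap WX = refl
  edge-overlap XU = refl

  edge-window : ∀ {x y} → E1089 x y → NoSingle (bit₁ x) (bit₁ y) (bit₂ y)
  edge-window SV = inj₁ refl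
  edge-window UU = inj₁ refl
  edge-window UV = inj₁ refl
  edge-window VW = inj₂ refl
  edge-window WW = inj₁ refl
  edge-window WX = inj₁ refl
  edge-window XU = inj₂ refl

  good-wrap : ∀ {x y ws} → E1089 x y → Good y ws → Good x (wrap (bit₁ x) ws (bit₁ x))
  good-wrap {x} {y} e (bits , pal , windows , R , refl) =
    All-wrap⁺ (bit₁-bit x) bits (bit₁-bit x) ,
    palindrome-wrap⁺ pal ,
    (edge-window e , Windows-∷ʳ-palindrome pal windows (NoSingle-sym (edge-window e))) ,
    (bit₂ y ∷ R ∷ʳ bit₁ x) , cong (λ q → bit₁ x ∷ q ∷ bit₂ y ∷ R ∷ʳ bit₁ x) (sym (edge-overlap e))

  solution⇒word : ∀ x n {M} → M ∈ solutions x n → ∃ λ ws → Good x ws × length ws ≡ 2 + n × M ≡ digits ws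
  solution⇒word U zero (here refl) =
    0 ∷ 0 ∷ [] , (inj₁ refl ∷ inj₁ refl ∷ [] , refl , tt , [] , refl) , refl , refl
  solution⇒word W zero (here refl) =
    1 ∷ 1 ∷ [] , (inj₂ refl ∷ inj₂ refl ∷ [] , refl , tt , [] , refl) , refl , refl
  solution⇒word U (suc zero) (here refl) =
    0 ∷ 0 ∷ 0 ∷ [] , (inj₁ refl ∷ inj₁ refl ∷ inj₁ refl ∷ [] , refl , (inj₁ refl , tt) , [ 0 ] , refl) ,
    refl , refl
  solution⇒word W (suc zero) (here refl) =
    1 ∷ 1 ∷ 1 ∷ [] , (inj₂ refl ∷ inj₂ refl ∷ inj₂ refl ∷ [] , refl , (inj₁ refl , tt) , [ 1 ] , refl) ,
    refl , refl
  solution⇒word x (suc (suc n)) m with ∈-solutions⁻ x n m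
  ... | y , e , M′ , m′ , refl with solution⇒word y n m′
  ... | ws , good@(_ , pal , _ , R , refl) , len , refl =
    wrap (bit₁ x) ws (bit₁ x) , good-wrap e good ,
    trans (length-wrap (bit₁ x) ws (bit₁ x)) (cong (λ z → 2 + z) len) ,
    sym (digits-wrap (bit₁ x) (bit₁ y) (bit₂ y) R (reverse R) (palindrome-ends pal))

  successor : ∀ x r → x ≢ S → Bit r → NoSingle (bit₁ x) (bit₂ x) r →
    ∃ λ y → E1089 x y × bit₁ y ≡ bit₂ x × bit₂ y ≡ r × y ≢ S
  successor S _ x≢S _ _ = ⊥-elim (x≢S refl)
  successor U .0 _ (inj₁ refl) _ = U , UU , refl , refl , (λ ())
  successor U .1 _ (inj₂ refl) _ = V , UV , refl , refl , (λ ())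
  successor V .0 _ (inj₁ refl) (inj₁ ())
  successor V .0 _ (inj₁ refl) (inj₂ ())
  successor V .1 _ (inj₂ refl) _ = W , VW , refl , refl , (λ ())
  successor W .0 _ (inj₁ refl) _ = X , WX , refl , refl , (λ ())
  successor W .1 _ (inj₂ refl) _ = W , WW , refl , refl , (λ ())
  successor X .0 _ (inj₁ refl) _ = U , XU , refl , refl , (λ ())
  successor X .1 _ (inj₂ refl) (inj₁ ())
  successor X .1 _ (inj₂ refl) (inj₂ ())

  good-unwrap : ∀ {x ws n} → x ≢ S → Good x ws → length ws ≡ 4 + n →
    ∃₂ λ y (e : E1089 x y) → ∃ λ M → ws ≡ wrap (bit₁ x) M (bit₁ x) × Good y M × length M ≡ 2 + n × y ≢ S
  good-unwrap _ (_ , _ , _ , R₀ , refl) len with initLast R₀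
  good-unwrap _ (_ , _ , _ , _ , refl) () | []
  good-unwrap _ (_ , _ , _ , _ , refl) () | [] ∷ʳ′ _
  good-unwrap {x} x≢S (bits , pal , windows , _ , refl) len | (r ∷ R) ∷ʳ′ c
    with successor x r x≢S (All.head (All.tail (proj₁ (proj₂ (All-wrap⁻ bits))))) (proj₁ windows)
  ... | y , e , q≡ , r≡ , y≢S =
    y , e , M , cong (wrap (bit₁ x) M) (sym p≡c) ,
    (proj₁ (proj₂ (All-wrap⁻ bits)) , palM , Windows-init M c (Windows-tail (bit₁ x) (M ∷ʳ c) windows) ,
     R , cong₂ (λ q r → q ∷ r ∷ R) (sym q≡) (sym r≡)) ,
    suc-injective (suc-injective (trans (sym (length-wrap (bit₁ x) M c)) len)) , y≢S
    where
    M = bit₂ x ∷ r ∷ R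
    p≡c = proj₁ (palindrome-wrap⁻ {bit₁ x} {M} {c} pal)
    palM = proj₂ (palindrome-wrap⁻ {bit₁ x} {M} {c} pal)

  word⇒solution : ∀ x n {ws} → x ≢ S → Good x ws → length ws ≡ 2 + n → digits ws ∈ solutions x n
  word⇒solution S _ x≢S _ _ = ⊥-elim (x≢S refl)
  word⇒solution U zero _ (_ , _ , _ , [] , refl) _ = here refl
  word⇒solution W zero _ (_ , _ , _ , [] , refl) _ = here refl
  word⇒solution V zero _ (_ , () , _ , [] , refl) _
  word⇒solution X zero _ (_ , () , _ , [] , refl) _
  word⇒solution _ zero _ (_ , _ , _ , _ ∷ _ , refl) ()
  word⇒solution U (suc zero) _ (_ , refl , _ , _ ∷ [] , refl) _ = here refl
  word⇒solution W (suc zero) _ (_ , refl , _ , _ ∷ [] , refl) _ = here refl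
  word⇒solution V (suc zero) _ (_ , refl , (inj₁ () , _) , _ ∷ [] , refl) _
  word⇒solution V (suc zero) _ (_ , refl , (inj₂ () , _) , _ ∷ [] , refl) _
  word⇒solution X (suc zero) _ (_ , refl , (inj₁ () , _) , _ ∷ [] , refl) _
  word⇒solution X (suc zero) _ (_ , refl , (inj₂ () , _) , _ ∷ [] , refl) _
  word⇒solution _ (suc zero) _ (_ , _ , _ , [] , refl) ()
  word⇒solution _ (suc zero) _ (_ , _ , _ , _ ∷ _ ∷ _ , refl) ()
  word⇒solution x (suc (suc n)) x≢S good len with good-unwrap x≢S good len
  ... | y , e , M , refl , goodM@(_ , palM , _ , R , refl) , lenM , y≢S =
    subst (_∈ solutions x (2 + n))
      (sym (digits-wrap (bit₁ x) (bit₁ y) (bit₂ y) R (reverse R) (palindrome-ends palM)))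
      (∈-solutions⁺ e (word⇒solution y n y≢S goodM lenM))

  kb*1+b*0≡kb : k * b * 1 + b * 0 ≡ k * b
  kb*1+b*0≡kb = trans (cong₂ _+_ (*-identityʳ (k * b)) (*-zeroʳ b)) (+-identityʳ (k * b))

  φ-window : ∀ {x y z} → Bit x → Bit y → Bit z → NoSingle z y x → φ x y z + y ≡ k * b * x + b * z
  φ-window (inj₁ refl) (inj₁ refl) (inj₁ refl) _ = sym (cong₂ _+_ (*-zeroʳ (k * b)) (*-zeroʳ b))
  φ-window (inj₁ refl) (inj₁ refl) (inj₂ refl) _ =
    trans (+-identityʳ b) (sym (cong₂ _+_ (*-zeroʳ (k * b)) (*-identityʳ b)))
  φ-window (inj₁ refl) (inj₂ refl) (inj₁ refl) (inj₁ ())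
  φ-window (inj₁ refl) (inj₂ refl) (inj₁ refl) (inj₂ ())
  φ-window (inj₁ refl) (inj₂ refl) (inj₂ refl) _ =
    trans (+-comm b' 1) (sym (cong₂ _+_ (*-zeroʳ (k * b)) (*-identityʳ b)))
  φ-window (inj₂ refl) (inj₁ refl) (inj₁ refl) _ = trans (+-identityʳ (k * b)) (sym (kb*1+b*0≡kb ))
  φ-window (inj₂ refl) (inj₁ refl) (inj₂ refl) (inj₁ ())
  φ-window (inj₂ refl) (inj₁ refl) (inj₂ refl) (inj₂ ())
  φ-window (inj₂ refl) (inj₂ refl) (inj₁ refl) _ = trans (m∸n+n≡m {k * b} {1} (s≤s z≤n)) (sym kb*1+b*0≡kb)
  φ-window (inj₂ refl) (inj₂ refl) (inj₂ refl) _ =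
    trans (m∸n+n≡m {g} {1} (s≤s z≤n)) (trans g≡kb+b (sym (cong₂ _+_ (*-identityʳ (k * b)) (*-identityʳ b))))

  -- the identity φ x y z + y = k b x + b z, summed over all places
  digits-value : ∀ ws → All Bit ws → Windows (ws ++ 0 ∷ 0 ∷ []) →
    val g (digits (ws ++ 0 ∷ 0 ∷ [])) + val g (drop 1 ws) ≡ k * b * val g (drop 2 ws) + b * val g ws
  digits-value [] _ _ = sym (cong₂ _+_ (*-zeroʳ (k * b)) (*-zeroʳ b))
  digits-value (z ∷ []) (z-bit ∷ []) (z00 , _) =
    trans (regroup (φ 0 0 z) g) (trans (φ-window (inj₁ refl) (inj₁ refl) z-bit z00) (regroup′ (k * b) b z g))
    where
    regroup : ∀ P g → (P + g * 0) + 0 ≡ P + 0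
    regroup = solve-∀
    regroup′ : ∀ kb b z g → kb * 0 + b * z ≡ kb * 0 + b * (z + g * 0)
    regroup′ = solve-∀
  digits-value (z ∷ y ∷ []) (z-bit ∷ y-bit ∷ []) (zy0 , y00 , _) =
    trans (regroup (φ 0 y z) (φ 0 0 y) y g)
      (trans (cong₂ (λ L H → L + g * H) (φ-window (inj₁ refl) y-bit z-bit zy0)
                                         (φ-window (inj₁ refl) (inj₁ refl) y-bit y00))
        (regroup′ (k * b) b z y g))
    where
    regroup : ∀ P Q y g → (P + g * (Q + g * 0)) + (y + g * 0) ≡ (P + y) + g * (Q + 0)
    regroup = solve-∀
    regroup′ : ∀ kb b z y g → (kb * 0 + b * z) + g * (kb * 0 + b * y) ≡ kb * 0 + b * (z + g * (y + g * 0))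
    regroup′ = solve-∀
  digits-value (z ∷ y ∷ x ∷ ws) (z-bit ∷ y-bit ∷ x-bit ∷ bits) (zyx , windows) =
    trans (regroup (φ x y z) (val g (digits ((y ∷ x ∷ ws) ++ 0 ∷ 0 ∷ []))) y (val g (x ∷ ws)) g)
      (trans (cong₂ (λ L H → L + g * H) (φ-window x-bit y-bit z-bit zyx)
                                         (digits-value (y ∷ x ∷ ws) (y-bit ∷ x-bit ∷ bits) windows))
        (regroup′ (k * b) b x z (val g ws) (val g (y ∷ x ∷ ws)) g))
    where
    regroup : ∀ P D y X g → (P + g * D) + (y + g * X) ≡ (P + y) + g * (D + X)
    regroup = solve-∀
    regroup′ : ∀ kb b x z R Y g → (kb * x + b * z) + g * (kb * R + b * Y) ≡ kb * (x + g * R) + b * (z + g * Y)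
    regroup′ = solve-∀

  digits-pad-value : ∀ {β} → All Bit β → Windows (pad β) → val g (digits (pad β)) ≡ b * (g ^ 2 ∸ 1) * val g β
  digits-pad-value {β} bits windows = +-cancelʳ-≡ (g * val g β) _ _ (begin
    val g (digits (pad β)) + g * val g β
      ≡⟨ cong (λ z → val g (digits (pad β)) + z) (sym (+-identityˡ (g * val g β))) ⟩
    val g (digits (pad β)) + val g (0 ∷ β)
      ≡⟨ digits-value (0 ∷ 0 ∷ β) (inj₁ refl ∷ inj₁ refl ∷ bits) windows ⟩
    k * b * val g β + b * (g * (g * val g β))       ≡⟨ sym (γ-identity (val g β)) ⟩
    b * (g ^ 2 ∸ 1) * val g β + g * val g β         ∎)
    where
    open ≡-Reasoning
    γ-identity : ∀ B → b * (g ^ 2 ∸ 1) * B + g * B ≡ k * b * B + b * (g * (g * B))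
    γ-identity B = begin
      b * (g ^ 2 ∸ 1) * B + g * B            ≡⟨ cong (λ h → b * (g ^ 2 ∸ 1) * B + h * B) g≡kb+b ⟩
      b * (g ^ 2 ∸ 1) * B + (k * b + b) * B  ≡⟨ regroup b (g ^ 2 ∸ 1) B (k * b) ⟩
      k * b * B + b * (g ^ 2 ∸ 1 + 1) * B
        ≡⟨ cong (λ h → k * b * B + b * h * B) (m∸n+n≡m {g ^ 2} {1} (s≤s z≤n)) ⟩
      k * b * B + b * (g * (g * 1)) * B      ≡⟨ regroup′ (k * b) b g B ⟩
      k * b * B + b * (g * (g * B))          ∎
      where
      regroup : ∀ b X B kb → b * X * B + (kb + b) * B ≡ kb * B + b * (X + 1) * B
      regroup = solve-∀
      regroup′ : ∀ kb b g B → kb * B + b * (g * (g * 1)) * B ≡ kb * B + b * (g * (g * B))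
      regroup′ = solve-∀

  val-γ : val g (k * b ∷ g ∸ 1 ∷ b ∸ 1 ∷ []) ≡ b * (g ^ 2 ∸ 1)
  val-γ = identity j b'
    where
    identity : ∀ j b' →
      (2 + j) * (1 + b') +
        (1 + b') * (3 + j) * ((2 + j + b' * (3 + j)) + (1 + b') * (3 + j) * (b' + (1 + b') * (3 + j) * 0))
      ≡ (1 + b') * ((2 + j + b' * (3 + j)) * 1 + (2 + j + b' * (3 + j)) * (1 + (2 + j + b' * (3 + j)) * 1))
    identity = solve-∀

  pad-wrap : ∀ β → wrap 0 (wrap 0 β 0) 0 ≡ pad β
  pad-wrap β = cong (λ t → 0 ∷ 0 ∷ t) (++-assoc β [ 0 ] [ 0 ])

  V-word-shape : ∀ {ws} → Good V ws → ∃ λ R → ws ≡ wrap 0 (1 ∷ R) 0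
  V-word-shape (_ , pal , _ , R , refl) with initLast R
  V-word-shape (_ , () , _ , _ , refl) | []
  ... | R′ ∷ʳ′ c = R′ , cong (wrap 0 (1 ∷ R′)) (sym (proj₁ (palindrome-wrap⁻ {0} {1 ∷ R′} {c} pal)))

  V-word-windows : ∀ {R} → Good V (wrap 0 (1 ∷ R) 0) → Windows (pad (1 ∷ R))
  V-word-windows {R} good = subst Windows (pad-wrap (1 ∷ R)) (proj₁ (proj₂ (proj₂ (good-wrap SV good))))

  V-word-value : ∀ {R} → Good V (wrap 0 (1 ∷ R) 0) →
    val g (wrap (low SV) (digits (wrap 0 (1 ∷ R) 0)) (high SV)) ≡ b * (g ^ 2 ∸ 1) * val g (1 ∷ R)
  V-word-value {R} good@(bits , pal , _) = begin
    val g (wrap (low SV) (digits ws) (high SV))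
      ≡⟨ cong (val g) (sym (digits-wrap 0 0 1 (R ∷ʳ 0) _ (palindrome-ends pal))) ⟩
    val g (digits (wrap 0 ws 0))                 ≡⟨ cong (λ t → val g (digits t)) (pad-wrap (1 ∷ R)) ⟩
    val g (digits (pad (1 ∷ R)))
      ≡⟨ digits-pad-value {1 ∷ R} (proj₁ (proj₂ (All-wrap⁻ {a = 0} {1 ∷ R} {0} bits))) (V-word-windows good) ⟩
    b * (g ^ 2 ∸ 1) * val g (1 ∷ R)              ∎
    where
    open ≡-Reasoning
    ws = wrap 0 (1 ∷ R) 0

  V-word⇒multiplier : ∀ {R} → Good V (wrap 0 (1 ∷ R) 0) → IsBeta g (val g (1 ∷ R))
  V-word⇒multiplier {R} good@(bits , pal , _) =
    s≤s z≤n , 1 ∷ R , All.map bit<g bitsβ , subst HeadNZ palβ (λ ()) , refl , palβ , bitsβ ,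
    windows⇒noSingles (1 ∷ R) refl palβ (V-word-windows good)
    where
    bitsβ = proj₁ (proj₂ (All-wrap⁻ {a = 0} {1 ∷ R} {0} bits))
    palβ = proj₂ (palindrome-wrap⁻ {0} {1 ∷ R} {0} pal)
    bit<g : ∀ {d} → Bit d → d < g
    bit<g (inj₁ refl) = z<s
    bit<g (inj₂ refl) = s≤s (s≤s z≤n)

  multiplier⇒V-word : ∀ {β} → IsBeta g β → ∃ λ R → Good V (wrap 0 (1 ∷ R) 0) × val g (1 ∷ R) ≡ β
  multiplier⇒V-word (_ , [] , _ , () , _)
  multiplier⇒V-word (_ , h ∷ R , _ , last≢0 , refl , pal , h-bit ∷ bits , noSingles) with h-bit
  ... | inj₁ refl = ⊥-elim (subst HeadNZ (sym pal) last≢0 refl)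
  ... | inj₂ refl =
    R , (All-wrap⁺ (inj₁ refl) (inj₂ refl ∷ bits) (inj₁ refl) , palindrome-wrap⁺ pal ,
         Windows-init _ 0 (Windows-tail 0 _
           (subst Windows (sym (pad-wrap (1 ∷ R))) (noSingles⇒windows (1 ∷ R) noSingles))) ,
         R ∷ʳ 0 , refl) ,
    refl

  module Isomorphism (f : V1089 → Node) (iso : IsIso1089 g k f) where

    private
      fS≡start = proj₁ iso
      onto = proj₁ (proj₂ (proj₂ (proj₂ iso)))
      adjacent = proj₁ (proj₂ (proj₂ (proj₂ (proj₂ iso))))
      even = proj₁ (proj₂ (proj₂ (proj₂ (proj₂ (proj₂ iso)))))
      odd = proj₂ (proj₂ (proj₂ (proj₂ (proj₂ (proj₂ iso)))))

    adjY : ∀ {x y} (e : E1089 x y) → AdjY g k ⟦ x ⟧ ⟦ y ⟧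
    adjY {x} {y} e = high e , low e , inY x , inY y , realize e

    pull : ∀ {x y} → f x ≡ ⟦ x ⟧ → E1089 x y → ∃ λ z → E1089 x z × f z ≡ ⟦ y ⟧
    pull {x} {y} fx e with onto ⟦ y ⟧ (inY y)
    ... | z , fz = z , Equivalence.from (adjacent x z) (subst₂ (AdjY g k) (sym fx) (sym fz) (adjY e)) , fz

    -- S has the single successor V, V the single successor W, W the successors W and X, and X only U.
    fV : f V ≡ ⟦ V ⟧
    fV = from-S (pull fS≡start SV)
      where
      from-S : (∃ λ z → E1089 S z × f z ≡ ⟦ V ⟧) → f V ≡ ⟦ V ⟧
      from-S (.V , SV , fV) = fV

    fW : f W ≡ ⟦ W ⟧
    fW = from-V (pull fV VW)
      where
      from-V : (∃ λ z → E1089 V z × f z ≡ ⟦ W ⟧) → f W ≡ ⟦ W ⟧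
      from-V (.W , VW , fW) = fW

    fX : f X ≡ ⟦ X ⟧
    fX = from-W (pull fW WX)
      where
      from-W : (∃ λ z → E1089 W z × f z ≡ ⟦ X ⟧) → f X ≡ ⟦ X ⟧
      from-W (.X , WX , fX) = fX
      from-W (.W , WW , fW≡⟦X⟧) = ⊥-elim (⟦W⟧≢⟦X⟧ (trans (sym fW) fW≡⟦X⟧))

    fU : f U ≡ ⟦ U ⟧
    fU = from-X (pull fX XU)
      where
      from-X : (∃ λ z → E1089 X z × f z ≡ ⟦ U ⟧) → f U ≡ ⟦ U ⟧
      from-X (.U , XU , fU) = fU

    f≗⟦⟧ : ∀ x → f x ≡ ⟦ x ⟧
    f≗⟦⟧ S = fS≡start
    f≗⟦⟧ U = fU
    f≗⟦⟧ V = fV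
    f≗⟦⟧ W = fW
    f≗⟦⟧ X = fX

    Y-node : ∀ {v} → InY g k v → ∃ λ x → v ≡ ⟦ x ⟧
    Y-node {v} h = let (x , fx≡v) = onto v h in x , trans (sym fx≡v) (f≗⟦⟧ x)

    Y-edge : ∀ {x y c a} → Edge g k ⟦ x ⟧ c a ⟦ y ⟧ → Σ (E1089 x y) λ e → c ≡ high e × a ≡ low e
    Y-edge {x} {y} {c} {a} edge = e , edge-unique 1<k edge (realize e)
      where
      e : E1089 x y
      e = Equivalence.from (adjacent x y)
            (subst₂ (AdjY g k) (sym (f≗⟦⟧ x)) (sym (f≗⟦⟧ y)) (c , a , inY x , inY y , edge))

    Y-pivot : ∀ x → Pivot g k ⟦ x ⟧ → x ≡ U ⊎ x ≡ W
    Y-pivot x p with subst (Pivot g k) (sym (f≗⟦⟧ x)) p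
    ... | inj₁ isEven = Equivalence.from (even x) isEven
    ... | inj₂ isOdd = Equivalence.from (odd x) isOdd

    complete : ∀ x {M} → Shells M → Sol g k ⟦ x ⟧ M → M ∈ solutions x (length M)
    complete U empty _ = here refl
    complete W empty _ = here refl
    complete S empty (_ , () , _)
    complete V empty sol = ⊥-elim (not-even (sol-[]⁻ {g} {k} {⟦ V ⟧} sol))
      where
      not-even : ¬ ∃ λ s → ⟦ V ⟧ ≡ node s s
      not-even (_ , ())
    complete X empty sol = ⊥-elim (not-even (sol-[]⁻ {g} {k} {⟦ X ⟧} sol))
      where
      not-even : ¬ ∃ λ s → ⟦ X ⟧ ≡ node s s
      not-even (_ , ())
    complete S (single a) sol = ⊥-elim (start-[ a ] 1<k sol)
    complete U (single a) sol = loop (Y-edge {U} {U} (sol-[ a ]⁻ {g} {k} {0} {0} z<s sol))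
      where
      loop : Σ (E1089 U U) (λ e → a ≡ high e × a ≡ low e) → [ a ] ∈ solutions U 1
      loop (UU , _ , refl) = here refl
    complete V (single a) sol =
      ⊥-elim (no-edge (proj₁ (Y-edge {V} {X} (sol-[ a ]⁻ {g} {k} {0} {k ∸ 1} ≤-refl sol))))
      where
      no-edge : ¬ E1089 V X
      no-edge ()
    complete W (single a) sol = loop (Y-edge {W} {W} (sol-[ a ]⁻ {g} {k} {k ∸ 1} {k ∸ 1} ≤-refl sol))
      where
      loop : Σ (E1089 W W) (λ e → a ≡ high e × a ≡ low e) → [ a ] ∈ solutions W 1
      loop (WW , _ , refl) = here refl
    complete X (single a) sol =
      ⊥-elim (no-edge (proj₁ (Y-edge {X} {V} (sol-[ a ]⁻ {g} {k} {k ∸ 1} {0} z<s sol))))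
      where
      no-edge : ¬ E1089 X V
      no-edge ()
    complete x (layer a {M} c core) sol = peeled (sol-wrap⁻ z<s (path-bounded z<s tt (inH x)) sol)
      where
      peeled : (∃₂ λ s' r' → Edge g k ⟦ x ⟧ c a (node s' r') × Sol g k (node s' r') M) →
        wrap a M c ∈ solutions x (length (wrap a M c))
      peeled (s' , r' , edge , sol′) = next (Y-node (h , sol⇒pivot 1<k core h sol′))
        where
        h = inH x ▻ edge
        next : (∃ λ y → node s' r' ≡ ⟦ y ⟧) → wrap a M c ∈ solutions x (length (wrap a M c))
        next (y , eq) =
          let e , c≡ , a≡ = Y-edge (subst (Edge g k ⟦ x ⟧ c a) eq edge) in
          wrap∈solutions e c≡ a≡ (complete y core (subst (λ v → Sol g k v M) eq sol′))

    count≡ : ∀ t → count g k t ≡ length (solutions S t)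
    count≡ t =
      unique-length (Uniqueₚ.filter⁺ (isRMDigits? g k) (lists-unique g t)) (solutions-unique S t) (mk⇔ to from)
      where
      to : ∀ {ds} → ds ∈ filter (isRMDigits? g k) (lists g t) → ds ∈ solutions S t
      to {ds} m = let ds∈ , rm = ∈-filter⁻ (isRMDigits? g k) m in
        subst (λ n → ds ∈ solutions S n) (proj₁ (∈-lists⁻ t ds∈)) (complete S (shells ds) rm)
      from : ∀ {ds} → ds ∈ solutions S t → ds ∈ filter (isRMDigits? g k) (lists g t)
      from m = let rm = sound S t m in
        ∈-filter⁺ (isRMDigits? g k) (∈-lists⁺ t (∈-solutions⇒length S t m) (proj₁ rm)) rm

    S-solution⇒multiplier : ∀ t {ds} → ds ∈ solutions S t → ∃ λ β → IsBeta g β × val g ds ≡ b * (g ^ 2 ∸ 1) * β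
    S-solution⇒multiplier (suc (suc n)) m with ∈-map⁻ _ m
    ... | M , m′ , refl with solution⇒word V n m′
    ... | ws , good , _ , refl with V-word-shape good
    ... | R , refl = val g (1 ∷ R) , V-word⇒multiplier good , V-word-value good

    reverse-multiples : ∀ N → IsReverseMultiple g k N ⇔ ∃ λ β → IsBeta g β × N ≡ b * (g ^ 2 ∸ 1) * β
    reverse-multiples N = mk⇔ to from
      where
      to : IsReverseMultiple g k N → ∃ λ β → IsBeta g β × N ≡ b * (g ^ 2 ∸ 1) * β
      to (ds , rm , refl) = S-solution⇒multiplier (length ds) (complete S (shells ds) rm)
      from : (∃ λ β → IsBeta g β × N ≡ b * (g ^ 2 ∸ 1) * β) → IsReverseMultiple g k N
      from (β , isβ , refl) with multiplier⇒V-word isβ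
      ... | R , good , refl =
        wrap (low SV) (digits ws) (high SV) ,
        sound S (2 + length (1 ∷ R))
          (∈-solutions⁺ {n = length (1 ∷ R)} SV (word⇒solution V (length (1 ∷ R)) (λ ()) good (length-wrap 0 (1 ∷ R) 0))) ,
        V-word-value good
        where ws = wrap 0 (1 ∷ R) 0

    node-listed : ∀ x → ⟦ x ⟧ ∈ nodes1089 k
    node-listed S = here refl
    node-listed U = there (here refl)
    node-listed V = there (there (here refl))
    node-listed W = there (there (there (here refl)))
    node-listed X = there (there (there (there (here refl))))

    listed-node : ∀ {v} → v ∈ nodes1089 k → InY g k v
    listed-node (here refl) = inY S
    listed-node (there (here refl)) = inY U
    listed-node (there (there (here refl))) = inY V
    listed-node (there (there (there (here refl)))) = inY W
    listed-node (there (there (there (there (here refl))))) = inY X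

    edge-listed : ∀ {x y} (e : E1089 x y) → (⟦ x ⟧ , high e , low e , ⟦ y ⟧) ∈ edges1089 g k b
    edge-listed SV = here refl
    edge-listed UU = there (here refl)
    edge-listed UV = there (there (here refl))
    edge-listed VW = there (there (there (here refl)))
    edge-listed WW = there (there (there (there (here refl))))
    edge-listed WX = there (there (there (there (there (here refl)))))
    edge-listed XU = there (there (there (there (there (there (here refl))))))

    listed-edge : ∀ {u c a v} → (u , c , a , v) ∈ edges1089 g k b → EdgeY g k u c a v
    listed-edge (here refl) = inY S , inY V , realize SV
    listed-edge (there (here refl)) = inY U , inY U , realize UU
    listed-edge (there (there (here refl))) = inY U , inY V , realize UV
    listed-edge (there (there (there (here refl)))) = inY V , inY W , realize VW
    listed-edge (there (there (there (there (here refl))))) = inY W , inY W , realize WW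
    listed-edge (there (there (there (there (there (here refl)))))) = inY W , inY X , realize WX
    listed-edge (there (there (there (there (there (there (here refl))))))) = inY X , inY U , realize XU

    nodes : ∀ v → InY g k v ⇔ v ∈ nodes1089 k
    nodes v = mk⇔ (λ h → let x , v≡ = Y-node h in subst (_∈ nodes1089 k) (sym v≡) (node-listed x)) listed-node

    edges : ∀ u c a v → EdgeY g k u c a v ⇔ (u , c , a , v) ∈ edges1089 g k b
    edges u c a v = mk⇔ to listed-edge
      where
      to : EdgeY g k u c a v → (u , c , a , v) ∈ edges1089 g k b
      to (hu , hv , edge) with Y-node hu | Y-node hv
      ... | x , refl | y , refl with Y-edge edge
      ... | e , refl , refl = edge-listed e

    pivots : ∀ v → InY g k v → Pivot g k v ⇔ v ∈ node 0 0 ∷ node (k ∸ 1) (k ∸ 1) ∷ []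
    pivots v h = mk⇔ to from
      where
      to : Pivot g k v → v ∈ node 0 0 ∷ node (k ∸ 1) (k ∸ 1) ∷ []
      to p with Y-node h
      ... | x , refl with Y-pivot x p
      ... | inj₁ refl = here refl
      ... | inj₂ refl = there (here refl)
      from : v ∈ node 0 0 ∷ node (k ∸ 1) (k ∸ 1) ∷ [] → Pivot g k v
      from (here refl) = inj₁ (inH U , refl)
      from (there (here refl)) = inj₁ (inH W , refl)

    count≡fib : ∀ n → count g k (2 + n) ≡ fib ⌊ n /2⌋
    count≡fib n =
      trans (count≡ (2 + n)) (trans (length-outer SV (solutions V n)) (proj₁ (proj₂ (solutions-length n))))

    counts : (∀ t → t < 4 → count g k t ≡ 0) × count g k 4 ≢ 0 × (∀ t → 4 ≤ t → count g k t ≡ fib (t / 2 ∸ 1))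
    counts = short , (λ c₄≡0 → 1+n≢0 (trans (sym (count≡fib 2)) c₄≡0)) , long
      where
      short : ∀ t → t < 4 → count g k t ≡ 0
      short 0 _ = count≡ 0
      short 1 _ = count≡ 1
      short 2 _ = count≡fib 0
      short 3 _ = count≡fib 1
      short (suc (suc (suc (suc t)))) (s≤s (s≤s (s≤s (s≤s ()))))
      long : ∀ t → 4 ≤ t → count g k t ≡ fib (t / 2 ∸ 1)
      long 1 (s≤s ())
      long (suc (suc n)) _ = trans (count≡fib n) (cong (λ h → fib (h ∸ 1)) (⌊n/2⌋≡n/2 (2 + n)))

    generating : ∀ n → (genFun g k ⊛ denominator) n ≡ numerator n
    generating = generating-function (count g k) (count≡ 0) (count≡ 1) count≡fib

g/[k+1]≡b : ∀ b' j → suc b' * suc (suc (suc j)) / suc (suc (suc j)) ≡ suc b'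
g/[k+1]≡b b' j = m*n/n≡m (suc b') (suc (suc (suc j)))

theorem2 : (g k : ℕ) → 3 ≤ g → 2 ≤ k → k < g → suc k ∣ g → Is1089 g k →
    let b = g / suc k in
    ((∀ v → InY g k v ⇔ v ∈ nodes1089 k) ×
     (∀ u c a v → EdgeY g k u c a v ⇔ (u , c , a , v) ∈ edges1089 g k b) ×
     (∀ v → InY g k v → (Pivot g k v ⇔ v ∈ node 0 0 ∷ node (k ∸ 1) (k ∸ 1) ∷ []))) ×
    (∀ n → (genFun g k ⊛ poly (+ 1 ∷ + 0 ∷ -[1+ 0 ] ∷ + 0 ∷ -[1+ 0 ] ∷ [])) n
           ≡ poly (+ 0 ∷ + 0 ∷ + 0 ∷ + 0 ∷ + 1 ∷ + 1 ∷ []) n) ×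
    (val g (k * b ∷ g ∸ 1 ∷ b ∸ 1 ∷ []) ≡ b * (g ^ 2 ∸ 1) ×
     (∀ N → IsReverseMultiple g k N ⇔ ∃ λ β → IsBeta g β × N ≡ b * (g ^ 2 ∸ 1) * β)) ×
    ((∀ t → t < 4 → count g k t ≡ 0) × count g k 4 ≢ 0 ×
     (∀ t → 4 ≤ t → count g k t ≡ fib (t / 2 ∸ 1)))
theorem2 .(0 * suc k) k () _ _ (divides zero refl) _
theorem2 .(suc b' * suc (suc (suc j))) .(suc (suc j)) _ (s≤s (s≤s {n = j} z≤n)) _ (divides (suc b') refl)
  (_ , f , iso)
  rewrite g/[k+1]≡b b' j =
  (nodes , edges , pivots) , generating , (val-γ , reverse-multiples) , counts
  where
  open Young1089 j b'
  open Isomorphism f iso
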